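{- Let $m\ge 1$ and $n\ge 0$. The transitive closure of the relation $\prec$ on $m$-ballot paths of size $n$ is a lattice. This lattice is isomorphic to the sublattice of the Tamari lattice $\mathcal{T}_{mn}$ consisting of the Dyck paths that are larger than or equal to the Dyck path $u^m d^m u^m d^m \cdots u^m d^m$ (with $n$ factors $u^md^m$). Moreover, $\prec$ is the covering relation of this lattice.
   Context: An $m$-ballot path of size $n$ is a lattice path made of north steps $(0,1)$ and east steps $(1,0)$, starting at $(0,0)$, ending at $(mn,n)$, and never going below the line $x=my$. For two $m$-ballot paths $P,Q$ of size $n$, one writes $P\prec Q$ if there exists in $P$ an east step $a$ immediately followed by a north step $b$ such that $Q$ is obtained from $P$ by swapping $a$ and $S$, where $S$ is the shortest factor of $P$ that begins with $b$ and is a (translated) $m$-ballot path. A Dyck path of size $N$ is a path of $N$ up steps $u=(1,1)$ and $N$ down steps $d=(1,-1)$ from $(0,0)$ to $(2N,0)$ never going below the $x$-axis. For an up step $u$ of a Dyck path $P$, the excursion of $u$ in $P$ is the shortest factor of $P$ starting with $u$ that is a (translated) Dyck path. The Tamari lattice $\mathcal{T}_N$ is the set of Dyck paths of size $N$ ordered by the reflexive-transitive closure of the following covering relation: $Q$ covers $P$ if there is in $P$ a down step $d$ immediately followed by an up step $u$ such that $Q$ is obtained from $P$ by swapping $d$ and the excursion of $u$ in $P$. -}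

module Defs where

open import Level using (Level; _⊔_)
open import Data.Nat using (ℕ; zero; suc; _*_; _≤_)
open import Data.List using (List; []; _∷_; _++_; replicate; concat)
open import Data.Product using (Σ; _×_; _,_; proj₁; proj₂)
open import Data.Sum using (_⊎_)
open import Relation.Binary.PropositionalEquality using (_≡_)
open import Relation.Nullary using (¬_)
open import Relation.Binary.Core using (Rel)
open import Relation.Binary.Construct.Closure.ReflexiveTransitive using (Star)
open import Relation.Binary.Lattice.Structures using (IsLattice)
open import Function.Bundles using (_⇔_)

-- m-ballot paths: N = north step (0,1), E = east step (1,0)

data BStep : Set where
  N E : BStep

#N : List BStep → ℕ
#N []      = zero
#N (N ∷ p) = suc (#N p)
#N (E ∷ p) = #N p

#E : List BStep → ℕ
#E []      = zero
#E (N ∷ p) = #E p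
#E (E ∷ p) = suc (#E p)

AboveLine : ℕ → List BStep → Set
AboveLine m p = ∀ pre suf → pre ++ suf ≡ p → #E pre ≤ m * #N pre

IsBallot : ℕ → List BStep → Set
IsBallot m p = AboveLine m p × #E p ≡ m * #N p

BallotPath : ℕ → ℕ → List BStep → Set
BallotPath m n p = IsBallot m p × #N p ≡ n

ShortestBallotFactor : ℕ → List BStep → Set
ShortestBallotFactor m S =
  Σ (List BStep) (λ s → S ≡ N ∷ s) × IsBallot m S ×
  (∀ pre suf → pre ++ suf ≡ S → ¬ pre ≡ [] → IsBallot m pre → suf ≡ [])

Prec : ℕ → List BStep → List BStep → Set
Prec m P Q = Σ (List BStep) λ A → Σ (List BStep) λ S → Σ (List BStep) λ B →
  ShortestBallotFactor m S × P ≡ A ++ E ∷ S ++ B × Q ≡ A ++ S ++ E ∷ B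

Ballot : ℕ → ℕ → Set
Ballot m n = Σ (List BStep) (BallotPath m n)

PrecOn : ℕ → ℕ → List BStep → List BStep → Set
PrecOn m n p q = BallotPath m n p × BallotPath m n q × Prec m p q

_≈B_ : ∀ {m n} → Rel (Ballot m n) _
x ≈B y = proj₁ x ≡ proj₁ y

_≤B_ : ∀ {m n} → Rel (Ballot m n) _
_≤B_ {m} {n} x y = Star (PrecOn m n) (proj₁ x) (proj₁ y)

-- Dyck paths: U = up step (1,1), D = down step (1,-1)

data DStep : Set where
  U D : DStep

#U : List DStep → ℕ
#U []      = zero
#U (U ∷ p) = suc (#U p)
#U (D ∷ p) = #U p

#D : List DStep → ℕ
#D []      = zero
#D (U ∷ p) = #D p
#D (D ∷ p) = suc (#D p)

IsDyck : List DStep → Set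
IsDyck p = (∀ pre suf → pre ++ suf ≡ p → #D pre ≤ #U pre) × #D p ≡ #U p

DyckPath : ℕ → List DStep → Set
DyckPath k p = IsDyck p × #U p ≡ k

Excursion : List DStep → Set
Excursion S =
  Σ (List DStep) (λ s → S ≡ U ∷ s) × IsDyck S ×
  (∀ pre suf → pre ++ suf ≡ S → ¬ pre ≡ [] → IsDyck pre → suf ≡ [])

TamariCover : List DStep → List DStep → Set
TamariCover P Q = Σ (List DStep) λ A → Σ (List DStep) λ S → Σ (List DStep) λ B →
  Excursion S × P ≡ A ++ D ∷ S ++ B × Q ≡ A ++ S ++ D ∷ B

TamariCoverOn : ℕ → List DStep → List DStep → Set
TamariCoverOn k p q = DyckPath k p × DyckPath k q × TamariCover p q

_≤T[_]_ : List DStep → ℕ → List DStep → Set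
p ≤T[ k ] q = Star (TamariCoverOn k) p q

base : ℕ → ℕ → List DStep
base m n = concat (replicate n (replicate m U ++ replicate m D))

UpSet : ℕ → ℕ → Set
UpSet m n = Σ (List DStep) λ q → DyckPath (m * n) q × base m n ≤T[ m * n ] q

_≈U_ : ∀ {m n} → Rel (UpSet m n) _
x ≈U y = proj₁ x ≡ proj₁ y

_≤U_ : ∀ {m n} → Rel (UpSet m n) _
_≤U_ {m} {n} x y = proj₁ x ≤T[ m * n ] proj₁ y

record OrderIso {a b ℓ₁ ℓ₂ ℓ₃ ℓ₄ : Level} {A : Set a} {B : Set b}
                (_≈₁_ : Rel A ℓ₁) (_≤₁_ : Rel A ℓ₂)
                (_≈₂_ : Rel B ℓ₃) (_≤₂_ : Rel B ℓ₄)
                : Set (a ⊔ b ⊔ ℓ₁ ⊔ ℓ₂ ⊔ ℓ₃ ⊔ ℓ₄) where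
  field
    to       : A → B
    from     : B → A
    to-cong  : ∀ {x y} → x ≈₁ y → to x ≈₂ to y
    from-cong : ∀ {x y} → x ≈₂ y → from x ≈₁ from y
    from-to  : ∀ x → from (to x) ≈₁ x
    to-from  : ∀ y → to (from y) ≈₂ y
    monotone : ∀ x y → (x ≤₁ y) ⇔ (to x ≤₂ to y)

Covers : ∀ {a ℓ₁ ℓ₂} {A : Set a} → Rel A ℓ₁ → Rel A ℓ₂ → A → A → Set (a ⊔ ℓ₁ ⊔ ℓ₂)
Covers {A = A} _≈_ _≤_ x y =
  x ≤ y × ¬ (x ≈ y) × (∀ (z : A) → x ≤ z → z ≤ y → (z ≈ x) ⊎ (z ≈ y))

-- A Dyck path U l D r is the binary tree node l r. Under this encoding a Tamari cover becomes a
-- rotation, and the Tamari order becomes the componentwise order on bracket vectors (for every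
-- node in preorder, one plus the size of its left subtree). Bracket vectors are exactly the
-- "nested" vectors, a condition closed under componentwise minima, so meets exist; joins are meets
-- of the finitely many upper bounds.
-- Replacing each north step by u^m and each east step by d embeds m-ballot paths into Dyck paths
-- and turns ≺ into the Tamari cover. A cover of an image swaps a down step with an excursion that
-- is again an image, so the image is closed upwards. Each run u^m forces the bracket entries
-- m, m - 1, ..., 1, which the base path u^m d^m ⋯ u^m d^m attains, so the image is exactly the
-- up-set of the base. This up-set contains joins and (being above the base) meets, and ≺ is its
-- covering relation because two rotations of one tree are never comparable.

module Submission where

open import Defs
open import Data.Nat
open import Data.Nat.Properties
open import Data.List using (List; []; _∷_; _++_; length; replicate; cartesianProductWith)
open import Data.List.Properties
  using (++-assoc; ++-identityʳ; ∷-injective; ∷-injectiveʳ; ++-cancelˡ; ++-conicalʳ; length-++)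
open import Data.List.Relation.Binary.Pointwise as Pointwise
  using (Pointwise; []; _∷_; Pointwise-length; Pointwise-≡⇒≡; ++⁺)
open import Data.List.Membership.Propositional using (_∈_)
open import Data.List.Membership.Propositional.Properties using (∈-cartesianProductWith⁺)
open import Data.List.Relation.Unary.Any using (here; there)
open import Data.Product
open import Data.Sum using (_⊎_; inj₁; inj₂)
open import Data.Empty using (⊥; ⊥-elim)
open import Relation.Nullary using (¬_; Dec; yes; no)
open import Relation.Nullary.Decidable using (_×-dec_)
open import Relation.Binary.PropositionalEquality
open import Relation.Binary.Construct.Closure.ReflexiveTransitive using (Star; ε; _◅_; _◅◅_; gmap)
open import Relation.Binary.Lattice.Structures using (IsLattice)
open import Function.Bundles using (_⇔_; mk⇔)

++-split : ∀ {A : Set} (xs ys as bs : List A) → xs ++ ys ≡ as ++ bs →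
  (∃ λ m → as ≡ xs ++ m × ys ≡ m ++ bs) ⊎ (∃₂ λ y m → xs ≡ as ++ y ∷ m × bs ≡ y ∷ m ++ ys)
++-split []       ys as       bs eq = inj₁ (as , refl , eq)
++-split (x ∷ xs) ys []       bs eq = inj₂ (x , xs , refl , sym eq)
++-split (x ∷ xs) ys (a ∷ as) bs eq with ∷-injective eq
... | refl , eq′ with ++-split xs ys as bs eq′
... | inj₁ (m , p , q)     = inj₁ (m , cong (x ∷_) p , q)
... | inj₂ (y , m , p , q) = inj₂ (y , m , cong (x ∷_) p , q)

Pointwise-++⁻ : ∀ {A : Set} {R : A → A → Set} (a a′ : List A) {b b′} → length a ≡ length a′ →
  Pointwise R (a ++ b) (a′ ++ b′) → Pointwise R a a′ × Pointwise R b b′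
Pointwise-++⁻ []      []       _ rs       = [] , rs
Pointwise-++⁻ (_ ∷ a) (_ ∷ a′) e (r ∷ rs) = map₁ (r ∷_) (Pointwise-++⁻ a a′ (suc-injective e) rs)

++-injective : ∀ {A : Set} (a a′ : List A) {b b′} → length a ≡ length a′ →
  a ++ b ≡ a′ ++ b′ → a ≡ a′ × b ≡ b′
++-injective []      []       _ eq = refl , eq
++-injective (x ∷ a) (y ∷ a′) e eq with ∷-injective eq
... | refl , eq′ with ++-injective a a′ (suc-injective e) eq′
... | refl , eq″ = refl , eq″

#U-++ : ∀ p q → #U (p ++ q) ≡ #U p + #U q
#U-++ []      q = refl
#U-++ (U ∷ p) q = cong suc (#U-++ p q)
#U-++ (D ∷ p) q = #U-++ p q

#D-++ : ∀ p q → #D (p ++ q) ≡ #D p + #D q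
#D-++ []      q = refl
#D-++ (U ∷ p) q = #D-++ p q
#D-++ (D ∷ p) q = cong suc (#D-++ p q)

data DyckFrom : ℕ → List DStep → Set where
  done : DyckFrom 0 []
  up   : ∀ {h p} → DyckFrom (suc h) p → DyckFrom h (U ∷ p)
  down : ∀ {h p} → DyckFrom h p → DyckFrom (suc h) (D ∷ p)

-- IsDyckFrom 0 is IsDyck, definitionally.
IsDyckFrom : ℕ → List DStep → Set
IsDyckFrom h q = (∀ pre suf → pre ++ suf ≡ q → #D pre ≤ h + #U pre) × #D q ≡ h + #U q

DyckFrom⇒IsDyckFrom : ∀ {h q} → DyckFrom h q → IsDyckFrom h q
DyckFrom⇒IsDyckFrom done = (λ { [] _ _ → z≤n ; (_ ∷ _) _ () }) , refl
DyckFrom⇒IsDyckFrom {h} (up {p = p} w) with DyckFrom⇒IsDyckFrom w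
... | prefixes , total = prefixes′ , trans total (sym (+-suc h (#U p)))
  where
  prefixes′ : ∀ pre suf → pre ++ suf ≡ U ∷ p → #D pre ≤ h + #U pre
  prefixes′ []        suf e  = z≤n
  prefixes′ (U ∷ pre) suf e  = subst (#D pre ≤_) (sym (+-suc h (#U pre))) (prefixes pre suf (∷-injectiveʳ e))
  prefixes′ (D ∷ pre) suf ()
DyckFrom⇒IsDyckFrom {suc h} (down {p = p} w) with DyckFrom⇒IsDyckFrom w
... | prefixes , total = prefixes′ , cong suc total
  where
  prefixes′ : ∀ pre suf → pre ++ suf ≡ D ∷ p → #D pre ≤ suc h + #U pre
  prefixes′ []        suf e  = z≤n
  prefixes′ (D ∷ pre) suf e  = s≤s (prefixes pre suf (∷-injectiveʳ e))
  prefixes′ (U ∷ pre) suf ()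

IsDyckFrom⇒DyckFrom : ∀ h q → IsDyckFrom h q → DyckFrom h q
IsDyckFrom⇒DyckFrom h [] (_ , total) =
  subst (λ x → DyckFrom x []) (sym (trans (sym (+-identityʳ h)) (sym total))) done
IsDyckFrom⇒DyckFrom h (U ∷ p) (prefixes , total) =
  up (IsDyckFrom⇒DyckFrom (suc h) p (prefixes′ , trans total (+-suc h (#U p))))
  where
  prefixes′ : ∀ pre suf → pre ++ suf ≡ p → #D pre ≤ suc h + #U pre
  prefixes′ pre suf e = subst (#D pre ≤_) (+-suc h (#U pre)) (prefixes (U ∷ pre) suf (cong (U ∷_) e))
IsDyckFrom⇒DyckFrom zero (D ∷ p) (prefixes , _) with prefixes (D ∷ []) p refl
... | ()
IsDyckFrom⇒DyckFrom (suc h) (D ∷ p) (prefixes , total) =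
  down (IsDyckFrom⇒DyckFrom h p
    ((λ pre suf e → s≤s⁻¹ (prefixes (D ∷ pre) suf (cong (D ∷_) e))) , suc-injective total))

-- Dyck paths as binary trees

data Tree : Set where
  leaf : Tree
  node : Tree → Tree → Tree

dyck : Tree → List DStep
dyck leaf       = []
dyck (node l r) = U ∷ dyck l ++ D ∷ dyck r

size : Tree → ℕ
size leaf       = 0
size (node l r) = suc (size l + size r)

dyck-node-++ : ∀ l r X → dyck (node l r) ++ X ≡ U ∷ dyck l ++ D ∷ dyck r ++ X
dyck-node-++ l r X = cong (U ∷_) (++-assoc (dyck l) (D ∷ dyck r) X)

#U-dyck : ∀ t → #U (dyck t) ≡ size t
#U-dyck leaf       = refl
#U-dyck (node l r) = cong suc (trans (#U-++ (dyck l) (D ∷ dyck r)) (cong₂ _+_ (#U-dyck l) (#U-dyck r)))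

dyck-++-DyckFrom : ∀ t {h X} → DyckFrom h X → DyckFrom h (dyck t ++ X)
dyck-++-DyckFrom leaf       w = w
dyck-++-DyckFrom (node l r) {h} {X} w =
  subst (DyckFrom h) (sym (dyck-node-++ l r X)) (up (dyck-++-DyckFrom l (down (dyck-++-DyckFrom r w))))

dyck-DyckFrom : ∀ t → DyckFrom 0 (dyck t)
dyck-DyckFrom t = subst (DyckFrom 0) (++-identityʳ (dyck t)) (dyck-++-DyckFrom t done)

dyck-isDyck : ∀ t → IsDyck (dyck t)
dyck-isDyck t = DyckFrom⇒IsDyckFrom (dyck-DyckFrom t)

-- What remains after the first tree of a path from height h: the rest of the descent to the axis.
Closing : ℕ → List DStep → Set
Closing zero    rest = rest ≡ []
Closing (suc h) rest = ∃ λ rest′ → rest ≡ D ∷ rest′ × DyckFrom h rest′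

-- The first argument bounds the length of the path and makes the recursion structural.
parse : ∀ n {h} q → length q ≤ n → DyckFrom h q →
  ∃₂ λ t rest → q ≡ dyck t ++ rest × Closing h rest
parse n       []      _ done = leaf , [] , refl , refl
parse n       (D ∷ p) _ (down w) = leaf , D ∷ p , refl , (p , refl , w)
parse zero    (U ∷ p) () (up w)
parse (suc n) (U ∷ p) (s≤s len) (up w) with parse n p len w
... | l , _ , p≡l , (rest′ , refl , w′) with parse n rest′ len′ w′
  where
  len′ : length rest′ ≤ n
  len′ = ≤-trans (n≤1+n _)
    (≤-trans (≤-trans (m≤n+m _ _) (≤-reflexive (sym (length-++ (dyck l)))))
             (subst (λ x → length x ≤ n) p≡l len))
... | r , rest , rest′≡r , closing =
  node l r , rest ,
  trans (cong (U ∷_) (trans p≡l (cong (λ x → dyck l ++ D ∷ x) rest′≡r))) (sym (dyck-node-++ l r rest)) ,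
  closing

DyckFrom0⇒tree : ∀ {q} → DyckFrom 0 q → ∃ λ t → dyck t ≡ q
DyckFrom0⇒tree {q} w with parse (length q) q ≤-refl w
... | t , rest , q≡t , refl = t , trans (sym (++-identityʳ (dyck t))) (sym q≡t)

isDyck⇒tree : ∀ {q} → IsDyck q → ∃ λ t → dyck t ≡ q
isDyck⇒tree {q} isD = DyckFrom0⇒tree (IsDyckFrom⇒DyckFrom 0 q isD)

dyck-++-D-injective : ∀ l l′ {x y} → dyck l ++ D ∷ x ≡ dyck l′ ++ D ∷ y → l ≡ l′ × x ≡ y
dyck-++-D-injective leaf       leaf         e  = refl , ∷-injectiveʳ e
dyck-++-D-injective leaf       (node _ _)   ()
dyck-++-D-injective (node _ _) leaf         ()
dyck-++-D-injective (node a b) (node a′ b′) {x} {y} e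
  with dyck-++-D-injective a a′ (trans (sym (++-assoc (dyck a) (D ∷ dyck b) (D ∷ x)))
         (trans (∷-injectiveʳ e) (++-assoc (dyck a′) (D ∷ dyck b′) (D ∷ y))))
... | refl , e′ with dyck-++-D-injective b b′ e′
... | refl , e″ = refl , e″

dyck-injective : ∀ t t′ → dyck t ≡ dyck t′ → t ≡ t′
dyck-injective leaf       leaf         e  = refl
dyck-injective leaf       (node _ _)   ()
dyck-injective (node _ _) leaf         ()
dyck-injective (node l r) (node l′ r′) e with dyck-++-D-injective l l′ (∷-injectiveʳ e)
... | refl , e′ = cong (node l) (dyck-injective r r′ e′)

dyck-node-∷ʳ : ∀ l r → ∃ λ X → dyck (node l r) ≡ X ++ D ∷ []
dyck-node-∷ʳ l leaf       = U ∷ dyck l , refl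
dyck-node-∷ʳ l (node a b) with dyck-node-∷ʳ a b
... | X , e = U ∷ dyck l ++ D ∷ X ,
  trans (cong (λ z → U ∷ dyck l ++ D ∷ z) e) (cong (U ∷_) (sym (++-assoc (dyck l) (D ∷ X) (D ∷ []))))

raised : Tree → List DStep
raised s = dyck (node s leaf)

Primitive : List DStep → Set
Primitive S = ∃ λ s → S ≡ raised s

excursion⇒primitive : ∀ {S} → Excursion S → Primitive S
excursion⇒primitive ((s , refl) , isD , shortest) with isDyck⇒tree isD
... | leaf , ()
... | node l r , e
  with dyck-injective r leaf (shortest (dyck (node l leaf)) (dyck r) (trans (dyck-node-++ l leaf (dyck r)) e) (λ ())
                                      (dyck-isDyck (node l leaf)))
... | refl = l , sym e

primitive⇒excursion : ∀ {S} → Primitive S → Excursion S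
primitive⇒excursion (s , refl) = (dyck s ++ D ∷ [] , refl) , dyck-isDyck (node s leaf) , shortest
  where
  shortest : ∀ pre suf → pre ++ suf ≡ raised s → ¬ pre ≡ [] → IsDyck pre → suf ≡ []
  shortest pre suf e pre≢[] isD with isDyck⇒tree isD
  ... | leaf , refl = ⊥-elim (pre≢[] refl)
  ... | node a b , refl with dyck-++-D-injective a s (∷-injectiveʳ (trans (sym (dyck-node-++ a b suf)) e))
  ... | refl , e′ = ++-conicalʳ (dyck b) suf e′

-- Rotations and Tamari covers

graft : Tree → Tree → Tree
graft leaf       r = node r leaf
graft (node a b) r = node a (graft b r)

dyck-graft : ∀ l r → dyck (graft l r) ≡ dyck l ++ raised r
dyck-graft leaf       r = refl
dyck-graft (node a b) r =
  trans (cong (λ z → U ∷ dyck a ++ D ∷ z) (dyck-graft b r)) (sym (dyck-node-++ a b (raised r)))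

size-graft : ∀ l r → size (graft l r) ≡ size l + suc (size r)
size-graft leaf       r = cong suc (+-identityʳ (size r))
size-graft (node a b) r = cong suc (trans (cong (size a +_) (size-graft b r)) (sym (+-assoc (size a) (size b) _)))

-- Under dyck, this rotation is exactly the Tamari covering relation.
data Rotation : Tree → Tree → Set where
  rotate  : ∀ l r₁ r₂ → Rotation (node l (node r₁ r₂)) (node (graft l r₁) r₂)
  inLeft  : ∀ {l l′} r → Rotation l l′ → Rotation (node l r) (node l′ r)
  inRight : ∀ l {r r′} → Rotation r r′ → Rotation (node l r) (node l r′)

rotation-size : ∀ {t t′} → Rotation t t′ → size t ≡ size t′
rotation-size (rotate l r₁ r₂) =
  cong suc (trans (sym (+-assoc (size l) (suc (size r₁)) (size r₂)))
                  (cong (_+ size r₂) (sym (size-graft l r₁))))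
rotation-size (inLeft r ρ)  = cong (λ z → suc (z + size r)) (rotation-size ρ)
rotation-size (inRight l ρ) = cong (λ z → suc (size l + z)) (rotation-size ρ)

rotation⇒swap : ∀ {t t′} → Rotation t t′ → ∃₂ λ A s → ∃ λ B →
  dyck t ≡ A ++ D ∷ raised s ++ B × dyck t′ ≡ A ++ raised s ++ D ∷ B
rotation⇒swap (rotate l r₁ r₂) = U ∷ dyck l , r₁ , dyck r₂ ,
  cong (λ z → U ∷ dyck l ++ D ∷ U ∷ z) (sym (++-assoc (dyck r₁) (D ∷ []) (dyck r₂))) ,
  cong (U ∷_) (trans (cong (_++ D ∷ dyck r₂) (dyck-graft l r₁))
                     (++-assoc (dyck l) (raised r₁) (D ∷ dyck r₂)))
rotation⇒swap (inLeft r ρ) with rotation⇒swap ρ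
... | A , s , B , e , e′ = U ∷ A , s , B ++ D ∷ dyck r ,
  cong (U ∷_) (trans (cong (_++ D ∷ dyck r) e)
    (trans (++-assoc A (D ∷ raised s ++ B) (D ∷ dyck r))
           (cong (λ z → A ++ D ∷ z) (++-assoc (raised s) B (D ∷ dyck r))))) ,
  cong (U ∷_) (trans (cong (_++ D ∷ dyck r) e′)
    (trans (++-assoc A (raised s ++ D ∷ B) (D ∷ dyck r))
           (cong (A ++_) (++-assoc (raised s) (D ∷ B) (D ∷ dyck r)))))
rotation⇒swap (inRight l ρ) with rotation⇒swap ρ
... | A , s , B , e , e′ = U ∷ dyck l ++ D ∷ A , s , B ,
  cong (U ∷_) (trans (cong (λ z → dyck l ++ D ∷ z) e)
                     (sym (++-assoc (dyck l) (D ∷ A) (D ∷ raised s ++ B)))) ,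
  cong (U ∷_) (trans (cong (λ z → dyck l ++ D ∷ z) e′)
                     (sym (++-assoc (dyck l) (D ∷ A) (raised s ++ D ∷ B))))

rotation⇒cover : ∀ {t t′} → Rotation t t′ → TamariCover (dyck t) (dyck t′)
rotation⇒cover ρ with rotation⇒swap ρ
... | A , s , B , e , e′ = A , raised s , B , primitive⇒excursion (s , refl) , e , e′

DyckFrom-suffix : ∀ {h} p q → DyckFrom h (p ++ q) → ∃ λ h′ → DyckFrom h′ q
DyckFrom-suffix []      q w        = _ , w
DyckFrom-suffix (U ∷ p) q (up w)   = DyckFrom-suffix p q w
DyckFrom-suffix (D ∷ p) q (down w) = DyckFrom-suffix p q w

-- DyckFrom h m means that m ends h levels below its start; inside a Dyck path such a prefix
-- cannot be followed by a down step.
isDyck-no-return-D : ∀ {h q} m k → IsDyck q → q ≡ m ++ D ∷ k → DyckFrom h m → ⊥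
isDyck-no-return-D {h} m k (prefixes , _) refl w = 1+n≰n (begin
  suc (#U m)         ≤⟨ s≤s (m≤n+m (#U m) h) ⟩
  suc (h + #U m)     ≡⟨ cong suc (sym (proj₂ (DyckFrom⇒IsDyckFrom w))) ⟩
  suc (#D m)         ≡⟨ trans (+-comm 1 (#D m)) (sym (#D-++ m (D ∷ []))) ⟩
  #D (m ++ D ∷ [])   ≤⟨ prefixes (m ++ D ∷ []) k (++-assoc m (D ∷ []) k) ⟩
  #U (m ++ D ∷ [])   ≡⟨ trans (#U-++ m (D ∷ [])) (+-identityʳ (#U m)) ⟩
  #U m               ∎)
  where open ≤-Reasoning

rotateAt : ∀ l r s B → dyck r ≡ raised s ++ B →
  ∃ λ t′ → dyck t′ ≡ U ∷ dyck l ++ raised s ++ D ∷ B × Rotation (node l r) t′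
rotateAt l leaf         s B ()
rotateAt l (node r₁ r₂) s B e
  with dyck-++-D-injective r₁ s (trans (∷-injectiveʳ e) (++-assoc (dyck s) (D ∷ []) B))
... | refl , r₂≡B = node (graft l r₁) r₂ ,
  cong (U ∷_) (trans (cong₂ (λ a b → a ++ D ∷ b) (dyck-graft l r₁) r₂≡B)
                     (++-assoc (dyck l) (raised r₁) (D ∷ B))) ,
  rotate l r₁ r₂

swap⇒rotation : ∀ t A s B → dyck t ≡ A ++ D ∷ raised s ++ B →
  ∃ λ t′ → dyck t′ ≡ A ++ raised s ++ D ∷ B × Rotation t t′
swap⇒rotation leaf       []      s B ()
swap⇒rotation leaf       (_ ∷ _) s B ()
swap⇒rotation (node l r) []      s B ()
swap⇒rotation (node l r) (D ∷ A) s B ()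
swap⇒rotation (node l r) (U ∷ A) s B e
  with ++-split (dyck l) (D ∷ dyck r) A (D ∷ raised s ++ B) (∷-injectiveʳ e)
... | inj₁ ([] , A≡l , Dr≡DsB) with rotateAt l r s B (∷-injectiveʳ Dr≡DsB)
...   | t′ , e′ , ρ =
  t′ , trans e′ (cong (λ z → U ∷ z ++ raised s ++ D ∷ B) (sym (trans A≡l (++-identityʳ (dyck l))))) , ρ
swap⇒rotation (node l r) (U ∷ A) s B e
    | inj₁ (D ∷ m , A≡lDm , r≡msB) with swap⇒rotation r m s B (∷-injectiveʳ r≡msB)
...   | r′ , e′ , ρ = node l r′ ,
  cong (U ∷_) (trans (cong (λ z → dyck l ++ D ∷ z) e′)
    (trans (sym (++-assoc (dyck l) (D ∷ m) _)) (cong (_++ raised s ++ D ∷ B) (sym A≡lDm)))) ,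
  inRight l ρ
swap⇒rotation (node l r) (U ∷ A) s B e
    | inj₁ (U ∷ m , _ , ())
swap⇒rotation (node l r) (U ∷ A) s B e
    | inj₂ (U , m , _ , ())
swap⇒rotation (node l r) (U ∷ A) s B e
    | inj₂ (D , m , l≡ADm , sB≡mDr) with ++-split (raised s) B m (D ∷ dyck r) (∷-injectiveʳ sB≡mDr)
...   | inj₁ (k , m≡sk , B≡kDr)
  with swap⇒rotation l A s k (trans l≡ADm (cong (λ z → A ++ D ∷ z) m≡sk))
...     | l′ , e′ , ρ = node l′ r ,
  cong (U ∷_) (trans (cong (_++ D ∷ dyck r) e′) (trans (++-assoc A _ (D ∷ dyck r))
    (cong (A ++_) (trans (++-assoc (raised s) (D ∷ k) (D ∷ dyck r))
                         (cong (λ z → raised s ++ D ∷ z) (sym B≡kDr)))))) ,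
  inLeft r ρ
swap⇒rotation (node l r) (U ∷ A) s B e
    | inj₂ (D , m , _ , _) | inj₂ (U , k , _ , ())
swap⇒rotation (node l r) (U ∷ A) s B e
    | inj₂ (D , m , l≡ADm , _) | inj₂ (D , k , s≡mDk , _)
    with DyckFrom-suffix A (D ∷ m) (subst (DyckFrom 0) l≡ADm (dyck-DyckFrom l))
...   | _ , down w = ⊥-elim (isDyck-no-return-D m k (dyck-isDyck (node s leaf)) s≡mDk w)

cover⇒rotation : ∀ {t Q} → TamariCover (dyck t) Q → ∃ λ t′ → dyck t′ ≡ Q × Rotation t t′
cover⇒rotation {t} (A , S , B , exc , e , refl) with excursion⇒primitive exc
... | s , refl = swap⇒rotation t A s B e

dyck-DyckPath : ∀ t → DyckPath (size t) (dyck t)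
dyck-DyckPath t = dyck-isDyck t , #U-dyck t

rotations⇒tamari : ∀ {k t t′} → Star Rotation t t′ → size t ≡ k → dyck t ≤T[ k ] dyck t′
rotations⇒tamari ε        _    = ε
rotations⇒tamari (ρ ◅ ρs) refl =
  (dyck-DyckPath _ , subst (λ k → DyckPath k _) (sym (rotation-size ρ)) (dyck-DyckPath _) , rotation⇒cover ρ)
  ◅ rotations⇒tamari ρs (sym (rotation-size ρ))

tamari⇒rotations : ∀ {k P Q} → P ≤T[ k ] Q →
  ∀ t → dyck t ≡ P → ∃ λ t′ → dyck t′ ≡ Q × Star Rotation t t′
tamari⇒rotations ε                        t e    = t , e , ε
tamari⇒rotations ((_ , _ , cover) ◅ covers) t refl with cover⇒rotation cover
... | t₁ , refl , ρ with tamari⇒rotations covers t₁ refl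
... | t′ , e′ , ρs = t′ , e′ , ρ ◅ ρs

-- Bracket vectors

bracket : Tree → List ℕ
bracket leaf       = []
bracket (node l r) = suc (size l) ∷ bracket l ++ bracket r

length-bracket : ∀ t → length (bracket t) ≡ size t
length-bracket leaf       = refl
length-bracket (node l r) =
  cong suc (trans (length-++ (bracket l)) (cong₂ _+_ (length-bracket l) (length-bracket r)))

_≼_ : Tree → Tree → Set
t ≼ u = Pointwise _≤_ (bracket t) (bracket u)

≼-refl : ∀ {t} → t ≼ t
≼-refl = Pointwise.refl ≤-refl

≼-trans : ∀ {t u v} → t ≼ u → u ≼ v → t ≼ v
≼-trans = Pointwise.transitive ≤-trans

≼? : ∀ t u → Dec (t ≼ u)
≼? t u = Pointwise.decidable _≤?_ (bracket t) (bracket u)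

≼-size : ∀ {t u} → t ≼ u → size t ≡ size u
≼-size {t} {u} t≼u = trans (sym (length-bracket t)) (trans (Pointwise-length t≼u) (length-bracket u))

bracket-injective : ∀ t t′ → bracket t ≡ bracket t′ → t ≡ t′
bracket-injective leaf       leaf         _ = refl
bracket-injective (node l r) (node l′ r′) e with ∷-injective e
... | hd , tl with ++-injective (bracket l) (bracket l′)
                     (trans (length-bracket l) (trans (suc-injective hd) (sym (length-bracket l′)))) tl
... | l≡l′ , r≡r′ = cong₂ node (bracket-injective l l′ l≡l′) (bracket-injective r r′ r≡r′)

≼-antisym : ∀ {t u} → t ≼ u → u ≼ t → t ≡ u
≼-antisym {t} {u} t≼u u≼t =
  bracket-injective t u (Pointwise-≡⇒≡ (Pointwise.antisymmetric ≤-antisym t≼u u≼t))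

node-≼⁻ : ∀ {x y} l l′ {r r′} → size l ≡ size l′ →
  Pointwise _≤_ (x ∷ bracket l ++ r) (y ∷ bracket l′ ++ r′) → l ≼ l′ × Pointwise _≤_ r r′
node-≼⁻ l l′ e (_ ∷ rs) =
  Pointwise-++⁻ (bracket l) (bracket l′) (trans (length-bracket l) (trans e (sym (length-bracket l′)))) rs

bracket-graft : ∀ l r → bracket (graft l r) ≡ bracket l ++ bracket (node r leaf)
bracket-graft leaf       r = refl
bracket-graft (node a b) r = cong (suc (size a) ∷_)
  (trans (cong (bracket a ++_) (bracket-graft b r)) (sym (++-assoc (bracket a) (bracket b) _)))

-- A root rotation only changes the root entry.
bracket-rotate : ∀ l r₁ r₂ → bracket (graft l r₁) ++ bracket r₂ ≡ bracket l ++ bracket (node r₁ r₂)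
bracket-rotate l r₁ r₂ =
  trans (cong (_++ bracket r₂) (bracket-graft l r₁))
  (trans (++-assoc (bracket l) (bracket (node r₁ leaf)) (bracket r₂))
         (cong (λ z → bracket l ++ suc (size r₁) ∷ z) (++-assoc (bracket r₁) [] (bracket r₂))))

size<size-graft : ∀ l r → size l < size (graft l r)
size<size-graft l r =
  subst (size l <_) (sym (trans (size-graft l r) (+-suc (size l) (size r)))) (s≤s (m≤m+n (size l) (size r)))

rotation-≼ : ∀ {t t′} → Rotation t t′ → t ≼ t′
rotation-≼ (rotate l r₁ r₂) =
  s≤s (<⇒≤ (size<size-graft l r₁)) ∷
  subst (Pointwise _≤_ _) (sym (bracket-rotate l r₁ r₂)) (Pointwise.refl ≤-refl)
rotation-≼ (inLeft r ρ)  =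
  ≤-reflexive (cong suc (rotation-size ρ)) ∷ ++⁺ (rotation-≼ ρ) (Pointwise.refl ≤-refl)
rotation-≼ (inRight l ρ) = ≤-refl ∷ ++⁺ (Pointwise.refl ≤-refl) (rotation-≼ ρ)

rotations-≼ : ∀ {t t′} → Star Rotation t t′ → t ≼ t′
rotations-≼ ε        = ≼-refl
rotations-≼ (ρ ◅ ρs) = ≼-trans (rotation-≼ ρ) (rotations-≼ ρs)

rotation-≢ : ∀ {t t′} → Rotation t t′ → t ≢ t′
rotation-≢ (rotate l r₁ r₂) e = <-irrefl (cong size (proj₁ (node-injective e))) (size<size-graft l r₁)
  where node-injective : ∀ {a b c d} → node a b ≡ node c d → a ≡ c × b ≡ d
        node-injective refl = refl , refl
rotation-≢ (inLeft r ρ)  refl = rotation-≢ ρ refl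
rotation-≢ (inRight l ρ) refl = rotation-≢ ρ refl

rotation-irreversible : ∀ {t t′} → Rotation t t′ → ¬ t′ ≼ t
rotation-irreversible ρ t′≼t = rotation-≢ ρ (≼-antisym (rotation-≼ ρ) t′≼t)

-- Out-of-range entries read as 0.
entry : List ℕ → ℕ → ℕ
entry []       _       = 0
entry (x ∷ _)  zero    = x
entry (_ ∷ xs) (suc i) = entry xs i

entry-++ˡ : ∀ a b {i} → i < length a → entry (a ++ b) i ≡ entry a i
entry-++ˡ (x ∷ a) b {zero}  _         = refl
entry-++ˡ (x ∷ a) b {suc i} (s≤s i<a) = entry-++ˡ a b i<a

entry-++ʳ : ∀ a b k → entry (a ++ b) (length a + k) ≡ entry b k
entry-++ʳ []      b k = refl
entry-++ʳ (x ∷ a) b k = entry-++ʳ a b k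

Pointwise⇒entry-≤ : ∀ {a b} → Pointwise _≤_ a b → ∀ i → entry a i ≤ entry b i
Pointwise⇒entry-≤ []       i       = z≤n
Pointwise⇒entry-≤ (p ∷ _)  zero    = p
Pointwise⇒entry-≤ (_ ∷ ps) (suc i) = Pointwise⇒entry-≤ ps i

entry-≤⇒Pointwise : ∀ a b → length a ≡ length b →
  (∀ i → i < length a → entry a i ≤ entry b i) → Pointwise _≤_ a b
entry-≤⇒Pointwise []      []      _ _ = []
entry-≤⇒Pointwise (x ∷ a) (y ∷ b) e f =
  f 0 z<s ∷ entry-≤⇒Pointwise a b (suc-injective e) (λ i i<a → f (suc i) (s<s i<a))

data Position (n : ℕ) : ℕ → Set where
  below  : ∀ {i} → i < n → Position n i
  beyond : ∀ k → Position n (n + k)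

position : ∀ n i → Position n i
position zero    i       = beyond i
position (suc n) zero    = below z<s
position (suc n) (suc i) with position n i
... | below i<n = below (s<s i<n)
... | beyond k  = beyond k

-- Position i spans the interval [i , i + f i) of the positions of its subtree;
-- these intervals are nested.
Nested : ℕ → (ℕ → ℕ) → Set
Nested n f = (∀ i → i < n → 1 ≤ f i × i + f i ≤ n) ×
             (∀ i j → i < n → i < j → j < i + f i → j + f j ≤ i + f i)

entry-bracketˡ : ∀ a b i → i < size a → entry (bracket a ++ bracket b) i ≡ entry (bracket a) i
entry-bracketˡ a b i i<a = entry-++ˡ (bracket a) (bracket b) (subst (i <_) (sym (length-bracket a)) i<a)

entry-bracketʳ : ∀ a b k → entry (bracket a ++ bracket b) (size a + k) ≡ entry (bracket b) k
entry-bracketʳ a b k = subst (λ z → entry (bracket a ++ bracket b) (z + k) ≡ entry (bracket b) k)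
  (length-bracket a) (entry-++ʳ (bracket a) (bracket b) k)

bracket-nested : ∀ t → Nested (size t) (entry (bracket t))
bracket-nested leaf       = (λ _ ()) , (λ _ _ ())
bracket-nested (node a b) = bounded , nesting
  where
  f fa fb : ℕ → ℕ
  f  = entry (bracket (node a b))
  fa = entry (bracket a)
  fb = entry (bracket b)
  sa sb : ℕ
  sa = size a
  sb = size b
  bounded : ∀ i → i < suc (sa + sb) → 1 ≤ f i × i + f i ≤ suc (sa + sb)
  bounded zero _ = s≤s z≤n , s≤s (m≤m+n sa sb)
  bounded (suc i) (s≤s i<) with position sa i
  ... | below i<a rewrite entry-bracketˡ a b i i<a =
    proj₁ (proj₁ (bracket-nested a) i i<a) ,
    s≤s (≤-trans (proj₂ (proj₁ (bracket-nested a) i i<a)) (m≤m+n sa sb))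
  ... | beyond k rewrite entry-bracketʳ a b k =
    proj₁ (proj₁ (bracket-nested b) k k<b) ,
    s≤s (subst (_≤ sa + sb) (sym (+-assoc sa k _)) (+-monoʳ-≤ sa (proj₂ (proj₁ (bracket-nested b) k k<b))))
    where
    k<b : k < sb
    k<b = +-cancelˡ-< sa k sb i<
  nesting : ∀ i j → i < suc (sa + sb) → i < j → j < i + f i → j + f j ≤ i + f i
  nesting zero (suc j) _ _ (s≤s j<a) rewrite entry-bracketˡ a b j j<a =
    s≤s (proj₂ (proj₁ (bracket-nested a) j j<a))
  nesting (suc i) (suc j) (s≤s i<) (s≤s i<j) (s≤s j<) with position sa i
  ... | below i<a rewrite entry-bracketˡ a b i i<a =
    s≤s (subst (λ z → j + z ≤ i + fa i) (sym (entry-bracketˡ a b j j<a))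
               (proj₂ (bracket-nested a) i j i<a i<j j<))
    where
    j<a : j < sa
    j<a = <-≤-trans j< (proj₂ (proj₁ (bracket-nested a) i i<a))
  ... | beyond k with position sa j
  ...   | below j<a = ⊥-elim (<-irrefl refl (<-≤-trans j<a (≤-trans (m≤m+n sa k) (<⇒≤ i<j))))
  ...   | beyond k′ rewrite entry-bracketʳ a b k | entry-bracketʳ a b k′
                          | +-assoc sa k (fb k) | +-assoc sa k′ (fb k′) =
    s≤s (+-monoʳ-≤ sa (proj₂ (bracket-nested b) k k′
      (+-cancelˡ-< sa k sb i<) (+-cancelˡ-< sa k k′ i<j) (+-cancelˡ-< sa k′ _ j<)))

-- The entry of r₁'s root sits at position size l, inside the span of l′.
rotate-≼-bound : ∀ l r₁ r₂ l′ r′ → size l < size l′ →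
  Pointwise _≤_ (bracket l ++ bracket (node r₁ r₂)) (bracket l′ ++ bracket r′) →
  size l + suc (size r₁) ≤ size l′
rotate-≼-bound l r₁ r₂ l′ r′ l<l′ ps = begin
  size l + suc (size r₁)                         ≡⟨ cong (_+ suc (size r₁)) (sym i≡l) ⟩
  i + suc (size r₁)                              ≡⟨ cong (i +_) (sym (entry-bracketʳ l (node r₁ r₂) 0)) ⟩
  i + entry (bracket l ++ bracket (node r₁ r₂)) i ≤⟨ +-monoʳ-≤ i (Pointwise⇒entry-≤ ps i) ⟩
  i + entry (bracket l′ ++ bracket r′) i         ≡⟨ cong (i +_) (entry-bracketˡ l′ r′ i i<l′) ⟩
  i + entry (bracket l′) i                       ≤⟨ proj₂ (proj₁ (bracket-nested l′) i i<l′) ⟩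
  size l′                                        ∎
  where
  open ≤-Reasoning
  i : ℕ
  i = size l + 0
  i≡l : i ≡ size l
  i≡l = +-identityʳ (size l)
  i<l′ : i < size l′
  i<l′ = subst (_< size l′) (sym i≡l) l<l′

≼⇒rotations : ∀ n t t′ → size t ≤ n → t ≼ t′ → Star Rotation t t′
≼⇒rotations _       leaf         leaf         _ _ = ε
≼⇒rotations zero    (node _ _)   (node _ _)   () _
≼⇒rotations (suc n) (node l₀ r₀) (node l′ r′) t≤n t≼t′ =
  rotateRoot (size l′) l₀ r₀ (m≤m+n (size l′) (size l₀)) t≤n t≼t′
  where
  -- Rotate at the root until the left subtrees have equal size; k bounds the number of rotations.
  rotateRoot : ∀ k l r → size l′ ≤ k + size l → size (node l r) ≤ suc n →
               node l r ≼ node l′ r′ → Star Rotation (node l r) (node l′ r′)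
  rotateRoot k l r _ t≤n (p ∷ ps) with m≤n⇒m<n∨m≡n (s≤s⁻¹ p)
  ... | inj₂ l≡l′ with node-≼⁻ l l′ l≡l′ (p ∷ ps)
  ...   | l≼l′ , r≼r′ =
    gmap (λ x → node x r) (inLeft r)
      (≼⇒rotations n l l′ (≤-trans (m≤m+n (size l) (size r)) (s≤s⁻¹ t≤n)) l≼l′) ◅◅
    gmap (node l′) (inRight l′)
      (≼⇒rotations n r r′ (≤-trans (m≤n+m (size r) (size l)) (s≤s⁻¹ t≤n)) r≼r′)
  rotateRoot k l leaf _ _ (p ∷ ps) | inj₁ l<l′ =
    ⊥-elim (<⇒≱ l<l′
      (subst (size l′ ≤_) (trans (sym sizes) (+-identityʳ (size l))) (m≤m+n (size l′) (size r′))))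
    where
    sizes : size l + 0 ≡ size l′ + size r′
    sizes = suc-injective (≼-size {node l leaf} {node l′ r′} (p ∷ ps))
  rotateRoot zero    l (node r₁ r₂) bound _ _ | inj₁ l<l′ = ⊥-elim (<⇒≱ l<l′ bound)
  rotateRoot (suc k) l (node r₁ r₂) bound t≤n (p ∷ ps) | inj₁ l<l′ =
    rotate l r₁ r₂ ◅ rotateRoot k (graft l r₁) r₂ bound′ t′≤n (head′ ∷ tail′)
    where
    bound′ : size l′ ≤ k + size (graft l r₁)
    bound′ = ≤-trans bound
      (≤-trans (≤-reflexive (sym (+-suc k (size l)))) (+-monoʳ-≤ k (size<size-graft l r₁)))
    t′≤n : size (node (graft l r₁) r₂) ≤ suc n
    t′≤n = subst (_≤ suc n) (rotation-size (rotate l r₁ r₂)) t≤n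
    head′ : suc (size (graft l r₁)) ≤ suc (size l′)
    head′ = s≤s (subst (_≤ size l′) (sym (size-graft l r₁))
                       (rotate-≼-bound l r₁ r₂ l′ r′ l<l′ ps))
    tail′ : Pointwise _≤_ (bracket (graft l r₁) ++ bracket r₂) (bracket l′ ++ bracket r′)
    tail′ = subst (λ z → Pointwise _≤_ z _) (sym (bracket-rotate l r₁ r₂)) ps

rotate-tail : ∀ {x y} l r₁ r₂ {r} →
  Pointwise _≤_ (x ∷ r) (y ∷ bracket (graft l r₁) ++ bracket r₂) →
  Pointwise _≤_ (x ∷ r) (y ∷ bracket l ++ bracket (node r₁ r₂))
rotate-tail l r₁ r₂ = subst (λ z → Pointwise _≤_ _ (_ ∷ z)) (bracket-rotate l r₁ r₂)

rotation-≼-unique : ∀ {t x y} → Rotation t x → Rotation t y → x ≼ y → x ≡ y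
rotation-≼-unique (rotate l r₁ r₂) (rotate .l .r₁ .r₂) _ = refl
rotation-≼-unique (rotate l r₁ r₂) (inLeft .(node r₁ r₂) ρ) (p ∷ _) =
  ⊥-elim (<⇒≱ (size<size-graft l r₁)
    (subst (size (graft l r₁) ≤_) (sym (rotation-size ρ)) (s≤s⁻¹ p)))
rotation-≼-unique (rotate l r₁ r₂) (inRight .l ρ) (p ∷ _) =
  ⊥-elim (<⇒≱ (size<size-graft l r₁) (s≤s⁻¹ p))
rotation-≼-unique (inLeft .(node r₁ r₂) ρ) (rotate l r₁ r₂) x≼y =
  ⊥-elim (rotation-irreversible ρ
    (proj₁ (node-≼⁻ _ l (sym (rotation-size ρ)) (rotate-tail l r₁ r₂ x≼y))))
rotation-≼-unique (inRight l ρ) (rotate .l r₁ r₂) x≼y =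
  ⊥-elim (rotation-irreversible ρ (proj₂ (node-≼⁻ l l refl (rotate-tail l r₁ r₂ x≼y))))
rotation-≼-unique (inLeft r ρ) (inLeft .r ρ′) x≼y =
  cong (λ z → node z r)
    (rotation-≼-unique ρ ρ′
      (proj₁ (node-≼⁻ _ _ (trans (sym (rotation-size ρ)) (rotation-size ρ′)) x≼y)))
rotation-≼-unique (inRight l ρ) (inRight .l ρ′) x≼y =
  cong (node l) (rotation-≼-unique ρ ρ′ (proj₂ (node-≼⁻ l l refl x≼y)))
rotation-≼-unique (inLeft r ρ) (inRight l ρ′) x≼y =
  ⊥-elim (rotation-irreversible ρ (proj₁ (node-≼⁻ _ l (sym (rotation-size ρ)) x≼y)))
rotation-≼-unique (inRight l ρ) (inLeft r ρ′) x≼y =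
  ⊥-elim (rotation-irreversible ρ (proj₂ (node-≼⁻ l _ (rotation-size ρ′) x≼y)))

nested-left : ∀ {n k f} → Nested (suc n) f → f 0 ≡ suc k → Nested k (λ i → f (suc i))
nested-left {n} {k} {f} (bounded , nesting) f0≡ = bounded′ , nesting′
  where
  k≤n : k ≤ n
  k≤n = s≤s⁻¹ (subst (_≤ suc n) f0≡ (proj₂ (bounded 0 z<s)))
  bounded′ : ∀ i → i < k → 1 ≤ f (suc i) × i + f (suc i) ≤ k
  bounded′ i i<k = proj₁ (bounded (suc i) (s≤s (≤-trans i<k k≤n))) ,
    s≤s⁻¹ (subst (suc i + f (suc i) ≤_) f0≡ (nesting 0 (suc i) z<s z<s (subst (suc i <_) (sym f0≡) (s<s i<k))))
  nesting′ : ∀ i j → i < k → i < j → j < i + f (suc i) → j + f (suc j) ≤ i + f (suc i)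
  nesting′ i j i<k i<j j< = s≤s⁻¹ (nesting (suc i) (suc j) (s≤s (≤-trans i<k k≤n)) (s<s i<j) (s<s j<))

nested-right : ∀ {n k f} → Nested (suc n) f → k ≤ n → Nested (n ∸ k) (λ i → f (suc (k + i)))
nested-right {n} {k} {f} (bounded , nesting) k≤n = bounded′ , nesting′
  where
  k+m≡n : k + (n ∸ k) ≡ n
  k+m≡n = m+[n∸m]≡n k≤n
  k+i<n : ∀ {i} → i < n ∸ k → k + i < n
  k+i<n i<m = subst (_ <_) k+m≡n (+-monoʳ-< _ i<m)
  g : ℕ → ℕ
  g i = f (suc (k + i))
  bounded′ : ∀ i → i < n ∸ k → 1 ≤ g i × i + g i ≤ n ∸ k
  bounded′ i i<m = proj₁ (bounded (suc (k + i)) (s<s (k+i<n i<m))) ,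
    +-cancelˡ-≤ k _ _ (subst₂ _≤_ (+-assoc k i (g i)) (sym k+m≡n)
      (s≤s⁻¹ (proj₂ (bounded (suc (k + i)) (s<s (k+i<n i<m))))))
  nesting′ : ∀ i j → i < n ∸ k → i < j → j < i + g i → j + g j ≤ i + g i
  nesting′ i j i<m i<j j< = +-cancelˡ-≤ k _ _ (subst₂ _≤_ (+-assoc k j (g j)) (+-assoc k i (g i))
    (s≤s⁻¹ (nesting (suc (k + i)) (suc (k + j)) (s<s (k+i<n i<m)) (s<s (+-monoʳ-< k i<j))
      (s<s (subst (k + j <_) (sym (+-assoc k i (g i))) (+-monoʳ-< k j<))))))

-- The root entry f 0 = 1 + k splits the remaining positions into k for the left subtree and
-- n ∸ k for the right one. The first argument bounds n and makes the recursion structural.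
nested⇒tree : ∀ F n f → n ≤ F → Nested n f →
  ∃ λ t → size t ≡ n × (∀ i → i < n → entry (bracket t) i ≡ f i)
nested⇒tree _       zero    f _ _ = leaf , refl , λ _ ()
nested⇒tree (suc F) (suc n) f (s≤s n≤F) isNested@(bounded , _) with f 0 in f0≡ | bounded 0 z<s
... | suc k | _ , s≤s k≤n = node l r , size-t , entries
  where
  m : ℕ
  m = n ∸ k
  k+m≡n : k + m ≡ n
  k+m≡n = m+[n∸m]≡n k≤n
  left : ∃ λ t → size t ≡ k × (∀ i → i < k → entry (bracket t) i ≡ f (suc i))
  left = nested⇒tree F k _ (≤-trans k≤n n≤F) (nested-left isNested f0≡)
  right : ∃ λ t → size t ≡ m × (∀ i → i < m → entry (bracket t) i ≡ f (suc (k + i)))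
  right = nested⇒tree F m _ (≤-trans (m∸n≤m n k) n≤F) (nested-right isNested k≤n)
  l r : Tree
  l = proj₁ left
  r = proj₁ right
  size-l : size l ≡ k
  size-l = proj₁ (proj₂ left)
  size-t : size (node l r) ≡ suc n
  size-t = cong suc (trans (cong₂ _+_ size-l (proj₁ (proj₂ right))) k+m≡n)
  entries : ∀ i → i < suc n → entry (bracket (node l r)) i ≡ f i
  entries zero    _ = trans (cong suc size-l) (sym f0≡)
  entries (suc i) (s≤s i<n) with position k i
  ... | below i<k = trans (entry-bracketˡ l r i (subst (i <_) (sym size-l) i<k)) (proj₂ (proj₂ left) i i<k)
  ... | beyond j  = trans (subst (λ z → entry (bracket l ++ bracket r) (z + j) ≡ entry (bracket r) j) size-l
                            (entry-bracketʳ l r j))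
                          (proj₂ (proj₂ right) j (+-cancelˡ-< k j m (subst (k + j <_) (sym k+m≡n) i<n)))

-- Meets and joins

nested-⊓ : ∀ {n f g} → Nested n f → Nested n g → Nested n (λ i → f i ⊓ g i)
nested-⊓ {n} {f} {g} (f-bounded , f-nesting) (g-bounded , g-nesting) = bounded , nesting
  where
  bounded : ∀ i → i < n → 1 ≤ f i ⊓ g i × i + (f i ⊓ g i) ≤ n
  bounded i i<n = ⊓-glb (proj₁ (f-bounded i i<n)) (proj₁ (g-bounded i i<n)) ,
                  ≤-trans (+-monoʳ-≤ i (m⊓n≤m (f i) (g i))) (proj₂ (f-bounded i i<n))
  nesting : ∀ i j → i < n → i < j → j < i + (f i ⊓ g i) → j + (f j ⊓ g j) ≤ i + (f i ⊓ g i)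
  nesting i j i<n i<j j< = subst₂ _≤_ (sym (+-distribˡ-⊓ j (f j) (g j))) (sym (+-distribˡ-⊓ i (f i) (g i)))
    (⊓-mono-≤ (f-nesting i j i<n i<j (<-≤-trans j< (+-monoʳ-≤ i (m⊓n≤m (f i) (g i)))))
              (g-nesting i j i<n i<j (<-≤-trans j< (+-monoʳ-≤ i (m⊓n≤n (f i) (g i))))))

bracket-nested-⊓ : ∀ t u → size t ≡ size u →
  Nested (size t) (λ i → entry (bracket t) i ⊓ entry (bracket u) i)
bracket-nested-⊓ t u t≡u =
  nested-⊓ (bracket-nested t) (subst (λ n → Nested n (entry (bracket u))) (sym t≡u) (bracket-nested u))

-- The meet has the componentwise minimum as bracket vector; on trees of different sizes it is junk.
meet : Tree → Tree → Tree
meet t u with size t ≟ size u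
... | yes t≡u = proj₁ (nested⇒tree (size t) (size t) _ ≤-refl (bracket-nested-⊓ t u t≡u))
... | no _    = t

IsMeet : Tree → Tree → Tree → Set
IsMeet t u m = m ≼ t × m ≼ u × (∀ z → z ≼ t → z ≼ u → z ≼ m)

IsJoin : Tree → Tree → Tree → Set
IsJoin t u j = t ≼ j × u ≼ j × (∀ z → t ≼ z → u ≼ z → j ≼ z)

meet-isMeet : ∀ t u → size t ≡ size u → IsMeet t u (meet t u)
meet-isMeet t u t≡u′ with size t ≟ size u
... | no t≢u = ⊥-elim (t≢u t≡u′)
... | yes t≡u with nested⇒tree (size t) (size t) _ ≤-refl (bracket-nested-⊓ t u t≡u)
... | m , size-m , entries = m≼t , m≼u , greatest
  where
  length-m : length (bracket m) ≡ size t
  length-m = trans (length-bracket m) size-m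
  entry-m : ∀ i → i < length (bracket m) → entry (bracket m) i ≡ entry (bracket t) i ⊓ entry (bracket u) i
  entry-m i i< = entries i (subst (i <_) length-m i<)
  m≼t : m ≼ t
  m≼t = entry-≤⇒Pointwise (bracket m) (bracket t) (trans length-m (sym (length-bracket t)))
    (λ i i< → subst (_≤ entry (bracket t) i) (sym (entry-m i i<)) (m⊓n≤m _ _))
  m≼u : m ≼ u
  m≼u = entry-≤⇒Pointwise (bracket m) (bracket u) (trans length-m (trans t≡u (sym (length-bracket u))))
    (λ i i< → subst (_≤ entry (bracket u) i) (sym (entry-m i i<)) (m⊓n≤n _ _))
  greatest : ∀ z → z ≼ t → z ≼ u → z ≼ m
  greatest z z≼t z≼u = entry-≤⇒Pointwise (bracket z) (bracket m) length-z
    (λ i i< → subst (entry (bracket z) i ≤_) (sym (entry-m i (subst (i <_) length-z i<)))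
                (⊓-glb (Pointwise⇒entry-≤ z≼t i) (Pointwise⇒entry-≤ z≼u i)))
    where
    length-z : length (bracket z) ≡ length (bracket m)
    length-z = trans (Pointwise-length z≼t) (trans (length-bracket t) (sym length-m))

comb : ℕ → Tree
comb zero    = leaf
comb (suc n) = node (comb n) leaf

size-comb : ∀ n → size (comb n) ≡ n
size-comb zero    = refl
size-comb (suc n) = cong suc (trans (+-identityʳ _) (size-comb n))

entry-bracket-comb : ∀ n i → entry (bracket (comb n)) i ≡ n ∸ i
entry-bracket-comb zero    zero    = refl
entry-bracket-comb zero    (suc i) = refl
entry-bracket-comb (suc n) zero    = cong suc (size-comb n)
entry-bracket-comb (suc n) (suc i) =
  trans (cong (λ z → entry z i) (++-identityʳ (bracket (comb n)))) (entry-bracket-comb n i)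

≼-comb : ∀ t → t ≼ comb (size t)
≼-comb t = entry-≤⇒Pointwise (bracket t) (bracket (comb (size t)))
  (trans (length-bracket t) (sym (trans (length-bracket _) (size-comb _))))
  (λ i i< → subst (entry (bracket t) i ≤_) (sym (entry-bracket-comb (size t) i))
     (subst (_≤ size t ∸ i) (m+n∸m≡n i (entry (bracket t) i))
       (∸-monoˡ-≤ i (proj₂ (proj₁ (bracket-nested t) i (subst (i <_) (length-bracket t) i<))))))

trees : ℕ → List Tree
trees zero    = leaf ∷ []
trees (suc n) = leaf ∷ cartesianProductWith node (trees n) (trees n)

∈-trees : ∀ t n → size t ≤ n → t ∈ trees n
∈-trees leaf       zero    _ = here refl
∈-trees leaf       (suc n) _ = here refl
∈-trees (node l r) (suc n) (s≤s t≤n) =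
  there (∈-cartesianProductWith⁺ node (∈-trees l n (≤-trans (m≤m+n _ _) t≤n))
                                      (∈-trees r n (≤-trans (m≤n+m _ _) t≤n)))

module _ (t u : Tree) where

  upperBound? : ∀ z → Dec (t ≼ z × u ≼ z)
  upperBound? z = ≼? t z ×-dec ≼? u z

  meetUpperBounds : List Tree → Tree → Tree
  meetUpperBounds []       acc = acc
  meetUpperBounds (z ∷ zs) acc with upperBound? z
  ... | yes _ = meetUpperBounds zs (meet acc z)
  ... | no _  = meetUpperBounds zs acc

  private
    meet-upperBound : ∀ {acc z} → t ≼ acc → u ≼ acc → t ≼ z → u ≼ z → IsMeet acc z (meet acc z)
    meet-upperBound t≼acc _ t≼z _ = meet-isMeet _ _ (trans (sym (≼-size t≼acc)) (≼-size t≼z))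

  meetUpperBounds-upperBound : ∀ zs acc → t ≼ acc → u ≼ acc →
    t ≼ meetUpperBounds zs acc × u ≼ meetUpperBounds zs acc
  meetUpperBounds-upperBound []       acc t≼acc u≼acc = t≼acc , u≼acc
  meetUpperBounds-upperBound (z ∷ zs) acc t≼acc u≼acc with upperBound? z
  ... | yes (t≼z , u≼z) = let _ , _ , greatest = meet-upperBound t≼acc u≼acc t≼z u≼z in
    meetUpperBounds-upperBound zs (meet acc z) (greatest t t≼acc t≼z) (greatest u u≼acc u≼z)
  ... | no _ = meetUpperBounds-upperBound zs acc t≼acc u≼acc

  meetUpperBounds-≼ : ∀ zs acc → t ≼ acc → u ≼ acc → meetUpperBounds zs acc ≼ acc
  meetUpperBounds-≼ []       acc _     _     = ≼-refl
  meetUpperBounds-≼ (z ∷ zs) acc t≼acc u≼acc with upperBound? z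
  ... | yes (t≼z , u≼z) = let m≼acc , _ , greatest = meet-upperBound t≼acc u≼acc t≼z u≼z in
    ≼-trans (meetUpperBounds-≼ zs (meet acc z) (greatest t t≼acc t≼z) (greatest u u≼acc u≼z)) m≼acc
  ... | no _ = meetUpperBounds-≼ zs acc t≼acc u≼acc

  meetUpperBounds-least : ∀ zs acc → t ≼ acc → u ≼ acc →
    ∀ z → z ∈ zs → t ≼ z → u ≼ z → meetUpperBounds zs acc ≼ z
  meetUpperBounds-least (z ∷ zs) acc t≼acc u≼acc z′ z′∈ t≼z′ u≼z′ with upperBound? z | z′∈
  ... | yes (t≼z , u≼z) | here refl = let _ , m≼z , greatest = meet-upperBound t≼acc u≼acc t≼z u≼z in
    ≼-trans (meetUpperBounds-≼ zs (meet acc z) (greatest t t≼acc t≼z) (greatest u u≼acc u≼z)) m≼z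
  ... | yes (t≼z , u≼z) | there z′∈zs = let _ , _ , greatest = meet-upperBound t≼acc u≼acc t≼z u≼z in
    meetUpperBounds-least zs (meet acc z) (greatest t t≼acc t≼z) (greatest u u≼acc u≼z)
      z′ z′∈zs t≼z′ u≼z′
  ... | no ¬ub | here refl   = ⊥-elim (¬ub (t≼z′ , u≼z′))
  ... | no _   | there z′∈zs = meetUpperBounds-least zs acc t≼acc u≼acc z′ z′∈zs t≼z′ u≼z′

-- Upper bounds exist and there are finitely many candidates, so the join is their meet.
join : Tree → Tree → Tree
join t u = meetUpperBounds t u (trees (size t)) (comb (size t))

join-isJoin : ∀ t u → size t ≡ size u → IsJoin t u (join t u)
join-isJoin t u t≡u = proj₁ bounds , proj₂ bounds , λ z t≼z u≼z →
  meetUpperBounds-least t u (trees (size t)) (comb (size t)) (≼-comb t) u≼comb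
    z (∈-trees z _ (≤-reflexive (sym (≼-size t≼z)))) t≼z u≼z
  where
  u≼comb : u ≼ comb (size t)
  u≼comb = subst (λ n → u ≼ comb n) (sym t≡u) (≼-comb u)
  bounds : t ≼ join t u × u ≼ join t u
  bounds = meetUpperBounds-upperBound t u (trees (size t)) (comb (size t)) (≼-comb t) u≼comb

-- Ballot paths as Dyck paths

replicate-++-∷ : ∀ {A : Set} n .{{_ : NonZero n}} (x : A) xs → ∃ λ ys → replicate n x ++ xs ≡ x ∷ ys
replicate-++-∷ (suc n) x xs = replicate n x ++ xs , refl

#U-replicate-U : ∀ n → #U (replicate n U) ≡ n
#U-replicate-U zero    = refl
#U-replicate-U (suc n) = cong suc (#U-replicate-U n)

replicate-U-≢-++-D : ∀ n X (Y : List DStep) → replicate n U ≢ X ++ D ∷ Y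
replicate-U-≢-++-D zero    []      Y ()
replicate-U-≢-++-D zero    (_ ∷ X) Y ()
replicate-U-≢-++-D (suc n) []      Y ()
replicate-U-≢-++-D (suc n) (U ∷ X) Y e = replicate-U-≢-++-D n X Y (∷-injectiveʳ e)
replicate-U-≢-++-D (suc n) (D ∷ X) Y ()

DyckFrom-replicate-U : ∀ j h X → DyckFrom (j + h) X → DyckFrom h (replicate j U ++ X)
DyckFrom-replicate-U zero    h X w = w
DyckFrom-replicate-U (suc j) h X w =
  up (DyckFrom-replicate-U j (suc h) X (subst (λ z → DyckFrom z X) (sym (+-suc j h)) w))

DyckFrom-replicate-U⁻ : ∀ j h X → DyckFrom h (replicate j U ++ X) → DyckFrom (j + h) X
DyckFrom-replicate-U⁻ zero    h X w      = w
DyckFrom-replicate-U⁻ (suc j) h X (up w) =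
  subst (λ z → DyckFrom z X) (+-suc j h) (DyckFrom-replicate-U⁻ j (suc h) X w)

DyckFrom-replicate-D : ∀ j h X → DyckFrom h X → DyckFrom (j + h) (replicate j D ++ X)
DyckFrom-replicate-D zero    h X w = w
DyckFrom-replicate-D (suc j) h X w = down (DyckFrom-replicate-D j h X w)

module Embedding (m : ℕ) where

  toDyck : List BStep → List DStep
  toDyck []      = []
  toDyck (N ∷ p) = replicate m U ++ toDyck p
  toDyck (E ∷ p) = D ∷ toDyck p

  toDyck-++ : ∀ p q → toDyck (p ++ q) ≡ toDyck p ++ toDyck q
  toDyck-++ []      q = refl
  toDyck-++ (N ∷ p) q =
    trans (cong (replicate m U ++_) (toDyck-++ p q)) (sym (++-assoc (replicate m U) (toDyck p) (toDyck q)))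
  toDyck-++ (E ∷ p) q = cong (D ∷_) (toDyck-++ p q)

  #U-toDyck : ∀ p → #U (toDyck p) ≡ m * #N p
  #U-toDyck []      = sym (*-zeroʳ m)
  #U-toDyck (N ∷ p) = begin
    #U (replicate m U ++ toDyck p)      ≡⟨ #U-++ (replicate m U) (toDyck p) ⟩
    #U (replicate m U) + #U (toDyck p)  ≡⟨ cong₂ _+_ (#U-replicate-U m) (#U-toDyck p) ⟩
    m + m * #N p                        ≡⟨ sym (*-suc m (#N p)) ⟩
    m * suc (#N p)                      ∎
    where open ≡-Reasoning
  #U-toDyck (E ∷ p) = #U-toDyck p

  module _ .{{_ : NonZero m}} where

    toDyck-N : ∀ p → ∃ λ q → toDyck (N ∷ p) ≡ U ∷ q
    toDyck-N p = replicate-++-∷ m U (toDyck p)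

    toDyck-injective : ∀ p q → toDyck p ≡ toDyck q → p ≡ q
    toDyck-injective []      []      _ = refl
    toDyck-injective []      (N ∷ q) e with toDyck-N q
    ... | _ , e′ with trans e e′
    ... | ()
    toDyck-injective (N ∷ p) []      e with toDyck-N p
    ... | _ , e′ with trans (sym e′) e
    ... | ()
    toDyck-injective (N ∷ p) (E ∷ q) e with toDyck-N p
    ... | _ , e′ with trans (sym e′) e
    ... | ()
    toDyck-injective (E ∷ p) (N ∷ q) e with toDyck-N q
    ... | _ , e′ with trans e e′
    ... | ()
    toDyck-injective (N ∷ p) (N ∷ q) e = cong (N ∷_) (toDyck-injective p q (++-cancelˡ (replicate m U) _ _ e))
    toDyck-injective (E ∷ p) (E ∷ q) e = cong (E ∷_) (toDyck-injective p q (∷-injectiveʳ e))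

    toDyck-≡[] : ∀ p → toDyck p ≡ [] → p ≡ []
    toDyck-≡[] p e = toDyck-injective p [] e

  toDyck-split-D : ∀ p X Y → toDyck p ≡ X ++ D ∷ Y →
    ∃₂ λ a b → p ≡ a ++ E ∷ b × X ≡ toDyck a × Y ≡ toDyck b
  toDyck-split-D [] [] Y ()
  toDyck-split-D [] (_ ∷ X) Y ()
  toDyck-split-D (E ∷ p) []      Y e  = [] , p , refl , refl , sym (∷-injectiveʳ e)
  toDyck-split-D (E ∷ p) (D ∷ X) Y e with toDyck-split-D p X Y (∷-injectiveʳ e)
  ... | a , b , p≡ , X≡ , Y≡ = E ∷ a , b , cong (E ∷_) p≡ , cong (D ∷_) X≡ , Y≡
  toDyck-split-D (N ∷ p) X Y e with ++-split (replicate m U) (toDyck p) X (D ∷ Y) e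
  ... | inj₁ (j , X≡Uj , p≡jDY) with toDyck-split-D p j Y p≡jDY
  ...   | a , b , p≡ , j≡ , Y≡ =
    N ∷ a , b , cong (N ∷_) p≡ , trans X≡Uj (cong (replicate m U ++_) j≡) , Y≡
  toDyck-split-D (N ∷ p) X Y e | inj₂ (U , j , _ , ())
  toDyck-split-D (N ∷ p) X Y e | inj₂ (D , j , U≡XDj , _) = ⊥-elim (replicate-U-≢-++-D m X j U≡XDj)

  IsBallotFrom : ℕ → List BStep → Set
  IsBallotFrom c p = (∀ pre suf → pre ++ suf ≡ p → #E pre ≤ c + m * #N pre) × #E p ≡ c + m * #N p

  private
    slack-N : ∀ c x → m + c + m * x ≡ c + m * suc x
    slack-N c x = trans (cong (_+ m * x) (+-comm m c)) (trans (+-assoc c m (m * x)) (cong (c +_) (sym (*-suc m x))))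

  isBallotFrom-N⁺ : ∀ {c p} → IsBallotFrom (m + c) p → IsBallotFrom c (N ∷ p)
  isBallotFrom-N⁺ {c} {p} (prefixes , total) = prefixes′ , trans total (slack-N c (#N p))
    where
    prefixes′ : ∀ pre suf → pre ++ suf ≡ N ∷ p → #E pre ≤ c + m * #N pre
    prefixes′ []        suf e  = z≤n
    prefixes′ (N ∷ pre) suf e  = subst (#E pre ≤_) (slack-N c (#N pre)) (prefixes pre suf (∷-injectiveʳ e))
    prefixes′ (E ∷ pre) suf ()

  isBallotFrom-N⁻ : ∀ {c p} → IsBallotFrom c (N ∷ p) → IsBallotFrom (m + c) p
  isBallotFrom-N⁻ {c} {p} (prefixes , total) =
    (λ pre suf e → subst (#E pre ≤_) (sym (slack-N c (#N pre))) (prefixes (N ∷ pre) suf (cong (N ∷_) e))) ,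
    trans total (sym (slack-N c (#N p)))

  isBallotFrom-E⁺ : ∀ {c p} → IsBallotFrom c p → IsBallotFrom (suc c) (E ∷ p)
  isBallotFrom-E⁺ {c} {p} (prefixes , total) = prefixes′ , cong suc total
    where
    prefixes′ : ∀ pre suf → pre ++ suf ≡ E ∷ p → #E pre ≤ suc c + m * #N pre
    prefixes′ []        suf e  = z≤n
    prefixes′ (E ∷ pre) suf e  = s≤s (prefixes pre suf (∷-injectiveʳ e))
    prefixes′ (N ∷ pre) suf ()

  isBallotFrom-E⁻ : ∀ {c p} → IsBallotFrom c (E ∷ p) → ∃ λ c′ → c ≡ suc c′ × IsBallotFrom c′ p
  isBallotFrom-E⁻ {zero}  {p} (prefixes , _) with subst (1 ≤_) (*-zeroʳ m) (prefixes (E ∷ []) p refl)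
  ... | ()
  isBallotFrom-E⁻ {suc c} {p} (prefixes , total) =
    c , refl , (λ pre suf e → s≤s⁻¹ (prefixes (E ∷ pre) suf (cong (E ∷_) e))) , suc-injective total

  isBallotFrom⇒DyckFrom : ∀ c p → IsBallotFrom c p → DyckFrom c (toDyck p)
  isBallotFrom⇒DyckFrom c [] (_ , total) =
    subst (λ z → DyckFrom z [])
      (sym (trans (sym (+-identityʳ c)) (trans (cong (c +_) (sym (*-zeroʳ m))) (sym total)))) done
  isBallotFrom⇒DyckFrom c (N ∷ p) b =
    DyckFrom-replicate-U m c (toDyck p) (isBallotFrom⇒DyckFrom (m + c) p (isBallotFrom-N⁻ {c} {p} b))
  isBallotFrom⇒DyckFrom c (E ∷ p) b with isBallotFrom-E⁻ {c} {p} b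
  ... | c′ , refl , b′ = down (isBallotFrom⇒DyckFrom c′ p b′)

  DyckFrom⇒isBallotFrom : ∀ c p → DyckFrom c (toDyck p) → IsBallotFrom c p
  DyckFrom⇒isBallotFrom .0 [] done = prefixes , sym (*-zeroʳ m)
    where
    prefixes : ∀ pre suf → pre ++ suf ≡ [] → #E pre ≤ m * #N pre
    prefixes []      suf e  = z≤n
    prefixes (_ ∷ _) suf ()
  DyckFrom⇒isBallotFrom c (N ∷ p) w =
    isBallotFrom-N⁺ {c} {p} (DyckFrom⇒isBallotFrom (m + c) p (DyckFrom-replicate-U⁻ m c (toDyck p) w))
  DyckFrom⇒isBallotFrom (suc c) (E ∷ p) (down w) = isBallotFrom-E⁺ {c} {p} (DyckFrom⇒isBallotFrom c p w)

  isBallot⇒isDyck : ∀ {p} → IsBallot m p → IsDyck (toDyck p)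
  isBallot⇒isDyck {p} b = DyckFrom⇒IsDyckFrom (isBallotFrom⇒DyckFrom 0 p b)

  isDyck⇒isBallot : ∀ {p} → IsDyck (toDyck p) → IsBallot m p
  isDyck⇒isBallot {p} isD = DyckFrom⇒isBallotFrom 0 p (IsDyckFrom⇒DyckFrom 0 (toDyck p) isD)

  module _ .{{_ : NonZero m}} where

    shortest⇒excursion : ∀ {S} → ShortestBallotFactor m S → Excursion (toDyck S)
    shortest⇒excursion {S} ((s , refl) , isB , shortest) = toDyck-N s , isBallot⇒isDyck isB , shortest′
      where
      shortest′ : ∀ pre suf → pre ++ suf ≡ toDyck S → ¬ pre ≡ [] → IsDyck pre → suf ≡ []
      shortest′ pre suf e pre≢[] isD with isDyck⇒tree isD
      ... | leaf , refl = ⊥-elim (pre≢[] refl)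
      ... | node l r , refl with dyck-node-∷ʳ l r
      ... | X , pre≡XD
        with toDyck-split-D S X suf (trans (sym e) (trans (cong (_++ suf) pre≡XD) (++-assoc X (D ∷ []) suf)))
      ... | a , b , S≡aEb , X≡a , suf≡b =
        trans suf≡b (cong toDyck (shortest (a ++ E ∷ []) b
          (trans (++-assoc a (E ∷ []) b) (sym S≡aEb)) (aE≢[] a)
          (isDyck⇒isBallot (subst IsDyck pre≡aE (dyck-isDyck (node l r))))))
        where
        aE≢[] : ∀ a → ¬ a ++ E ∷ [] ≡ []
        aE≢[] []      ()
        aE≢[] (_ ∷ _) ()
        pre≡aE : dyck (node l r) ≡ toDyck (a ++ E ∷ [])
        pre≡aE = trans pre≡XD (trans (cong (_++ D ∷ []) X≡a) (sym (toDyck-++ a (E ∷ []))))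

    excursion⇒shortest : ∀ s → Excursion (toDyck (N ∷ s)) → ShortestBallotFactor m (N ∷ s)
    excursion⇒shortest s (_ , isD , shortest) = (s , refl) , isDyck⇒isBallot isD , shortest′
      where
      shortest′ : ∀ pre suf → pre ++ suf ≡ N ∷ s → ¬ pre ≡ [] → IsBallot m pre → suf ≡ []
      shortest′ pre suf e pre≢[] isB = toDyck-≡[] suf
        (shortest (toDyck pre) (toDyck suf) (trans (sym (toDyck-++ pre suf)) (cong toDyck e))
          (λ pre≡[] → pre≢[] (toDyck-≡[] pre pre≡[])) (isBallot⇒isDyck isB))

    prec⇒cover : ∀ {P Q} → Prec m P Q → TamariCover (toDyck P) (toDyck Q)
    prec⇒cover (A , S , B , shortest , refl , refl) =
      toDyck A , toDyck S , toDyck B , shortest⇒excursion shortest ,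
      trans (toDyck-++ A (E ∷ S ++ B)) (cong (λ z → toDyck A ++ D ∷ z) (toDyck-++ S B)) ,
      trans (toDyck-++ A (S ++ E ∷ B)) (cong (toDyck A ++_) (toDyck-++ S (E ∷ B)))

    cover⇒prec : ∀ P Q′ → TamariCover (toDyck P) Q′ → ∃ λ Q → Q′ ≡ toDyck Q × Prec m P Q
    cover⇒prec P Q′ (A′ , S′ , B′ , exc , P≡ , refl)
      with toDyck-split-D P A′ (S′ ++ B′) P≡ | excursion⇒primitive exc
    ... | a , r , P≡aEr , A′≡a , r≡SB | s₀ , refl
      with toDyck-split-D r (U ∷ dyck s₀) B′
             (trans (sym r≡SB) (cong (U ∷_) (++-assoc (dyck s₀) (D ∷ []) B′)))
    ... | []      , _  , _    , ()  , _
    ... | E ∷ _   , _  , _    , ()  , _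
    ... | N ∷ s , b , r≡NsEb , Us₀≡Ns , B′≡b = a ++ S ++ E ∷ b , Q′≡ ,
      a , S , b , excursion⇒shortest (s ++ E ∷ []) (subst Excursion S′≡S exc) , P≡aESb , refl
      where
      S : List BStep
      S = N ∷ s ++ E ∷ []
      S′≡S : raised s₀ ≡ toDyck S
      S′≡S = trans (cong (_++ D ∷ []) Us₀≡Ns) (sym (toDyck-++ (N ∷ s) (E ∷ [])))
      P≡aESb : P ≡ a ++ E ∷ S ++ b
      P≡aESb = trans P≡aEr
        (cong (λ z → a ++ E ∷ z) (trans r≡NsEb (cong (N ∷_) (sym (++-assoc s (E ∷ []) b)))))
      Q′≡ : A′ ++ raised s₀ ++ D ∷ B′ ≡ toDyck (a ++ S ++ E ∷ b)
      Q′≡ = begin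
        A′ ++ raised s₀ ++ D ∷ B′
          ≡⟨ cong₂ _++_ A′≡a (cong₂ (λ x y → x ++ D ∷ y) S′≡S B′≡b) ⟩
        toDyck a ++ toDyck S ++ D ∷ toDyck b    ≡⟨ cong (toDyck a ++_) (sym (toDyck-++ S (E ∷ b))) ⟩
        toDyck a ++ toDyck (S ++ E ∷ b)         ≡⟨ sym (toDyck-++ a (S ++ E ∷ b)) ⟩
        toDyck (a ++ S ++ E ∷ b)                ∎
        where open ≡-Reasoning

-- The base path is below every image

-- Number of up steps of a path before it first goes h levels below its start.
upsBefore : ℕ → List DStep → ℕ
upsBefore zero    _       = 0
upsBefore (suc h) []      = 0
upsBefore (suc h) (U ∷ s) = suc (upsBefore (suc (suc h)) s)
upsBefore (suc h) (D ∷ s) = upsBefore h s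

bracketOf : List DStep → List ℕ
bracketOf []      = []
bracketOf (U ∷ s) = suc (upsBefore 1 s) ∷ bracketOf s
bracketOf (D ∷ s) = bracketOf s

upsBefore-dyck : ∀ t h X → upsBefore (suc h) (dyck t ++ X) ≡ size t + upsBefore (suc h) X
upsBefore-dyck leaf       h X = refl
upsBefore-dyck (node l r) h X
  rewrite ++-assoc (dyck l) (D ∷ dyck r) X | upsBefore-dyck l (suc h) (D ∷ dyck r ++ X) | upsBefore-dyck r h X =
  cong suc (sym (+-assoc (size l) (size r) _))

bracketOf-dyck-++ : ∀ t X → bracketOf (dyck t ++ X) ≡ bracket t ++ bracketOf X
bracketOf-dyck-++ leaf       X = refl
bracketOf-dyck-++ (node l r) X
  rewrite ++-assoc (dyck l) (D ∷ dyck r) X | upsBefore-dyck l 0 (D ∷ dyck r ++ X)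
        | bracketOf-dyck-++ l (D ∷ dyck r ++ X) | bracketOf-dyck-++ r X =
  cong₂ _∷_ (cong suc (+-identityʳ (size l))) (sym (++-assoc (bracket l) (bracket r) (bracketOf X)))

bracket≡bracketOf-dyck : ∀ t → bracket t ≡ bracketOf (dyck t)
bracket≡bracketOf-dyck t =
  sym (trans (cong bracketOf (sym (++-identityʳ (dyck t))))
             (trans (bracketOf-dyck-++ t []) (++-identityʳ (bracket t))))

upsBefore-replicate-U : ∀ j h X → upsBefore (suc h) (replicate j U ++ X) ≡ j + upsBefore (j + suc h) X
upsBefore-replicate-U zero    h X = refl
upsBefore-replicate-U (suc j) h X =
  cong suc (trans (upsBefore-replicate-U j (suc h) X) (cong (λ z → j + upsBefore z X) (+-suc j (suc h))))

upsBefore-replicate-D : ∀ h j X → h ≤ j → upsBefore h (replicate j D ++ X) ≡ 0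
upsBefore-replicate-D zero    j       X _         = refl
upsBefore-replicate-D (suc h) (suc j) X (s≤s h≤j) = upsBefore-replicate-D h j X h≤j

-- The bracket entries of the j up steps of replicate j U ++ Y.
runEntries : ℕ → List DStep → List ℕ
runEntries zero    Y = []
runEntries (suc j) Y = suc (upsBefore 1 (replicate j U ++ Y)) ∷ runEntries j Y

bracketOf-replicate-U : ∀ j Y → bracketOf (replicate j U ++ Y) ≡ runEntries j Y ++ bracketOf Y
bracketOf-replicate-U zero    Y = refl
bracketOf-replicate-U (suc j) Y = cong (suc (upsBefore 1 (replicate j U ++ Y)) ∷_) (bracketOf-replicate-U j Y)

bracketOf-replicate-D : ∀ j Y → bracketOf (replicate j D ++ Y) ≡ bracketOf Y
bracketOf-replicate-D zero    Y = refl
bracketOf-replicate-D (suc j) Y = bracketOf-replicate-D j Y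

countdown : ℕ → List ℕ
countdown zero    = []
countdown (suc j) = suc j ∷ countdown j

countdown-≤-runEntries : ∀ j Y → Pointwise _≤_ (countdown j) (runEntries j Y)
countdown-≤-runEntries zero    Y = []
countdown-≤-runEntries (suc j) Y =
  s≤s (subst (j ≤_) (sym (upsBefore-replicate-U j 0 Y)) (m≤m+n j _)) ∷ countdown-≤-runEntries j Y

runEntries-≤-countdown : ∀ j k X → j ≤ k → Pointwise _≤_ (runEntries j (replicate k D ++ X)) (countdown j)
runEntries-≤-countdown zero    k X _   = []
runEntries-≤-countdown (suc j) k X j<k =
  s≤s (≤-reflexive (trans (upsBefore-replicate-U j 0 _)
         (trans (cong (j +_) (upsBefore-replicate-D (j + 1) k X (subst (_≤ k) (+-comm 1 j) j<k)))
                (+-identityʳ j))))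
  ∷ runEntries-≤-countdown j k X (≤-trans (n≤1+n j) j<k)

module _ (m : ℕ) where
  open Embedding m

  blockCountdowns : ℕ → List ℕ
  blockCountdowns zero    = []
  blockCountdowns (suc n) = countdown m ++ blockCountdowns n

  base-suc : ∀ n → base m (suc n) ≡ replicate m U ++ replicate m D ++ base m n
  base-suc n = ++-assoc (replicate m U) (replicate m D) (base m n)

  base-DyckFrom : ∀ n → DyckFrom 0 (base m n)
  base-DyckFrom zero    = done
  base-DyckFrom (suc n) = subst (DyckFrom 0) (sym (base-suc n))
    (DyckFrom-replicate-U m 0 _ (DyckFrom-replicate-D m 0 _ (base-DyckFrom n)))

  bracketOf-base-≤ : ∀ n → Pointwise _≤_ (bracketOf (base m n)) (blockCountdowns n)
  bracketOf-base-≤ zero    = []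
  bracketOf-base-≤ (suc n) rewrite base-suc n
    | bracketOf-replicate-U m (replicate m D ++ base m n) | bracketOf-replicate-D m (base m n) =
    ++⁺ (runEntries-≤-countdown m m (base m n) ≤-refl) (bracketOf-base-≤ n)

  blockCountdowns-≤-toDyck : ∀ x → Pointwise _≤_ (blockCountdowns (#N x)) (bracketOf (toDyck x))
  blockCountdowns-≤-toDyck []      = []
  blockCountdowns-≤-toDyck (N ∷ x) rewrite bracketOf-replicate-U m (toDyck x) =
    ++⁺ (countdown-≤-runEntries m (toDyck x)) (blockCountdowns-≤-toDyck x)
  blockCountdowns-≤-toDyck (E ∷ x) = blockCountdowns-≤-toDyck x

  base≤toDyck : ∀ n x → BallotPath m n x → base m n ≤T[ m * n ] toDyck x
  base≤toDyck n x (isB , #N≡n) with DyckFrom0⇒tree (base-DyckFrom n) | isDyck⇒tree (isBallot⇒isDyck isB)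
  ... | b , b≡base | t , t≡x = subst₂ (λ p q → p ≤T[ m * n ] q) b≡base t≡x
    (rotations⇒tamari (≼⇒rotations (size b) b t ≤-refl b≼t) size-b)
    where
    b≼t : b ≼ t
    b≼t = subst₂ (Pointwise _≤_) (sym (trans (bracket≡bracketOf-dyck b) (cong bracketOf b≡base)))
                                  (sym (trans (bracket≡bracketOf-dyck t) (cong bracketOf t≡x)))
      (Pointwise.transitive ≤-trans (bracketOf-base-≤ n)
        (subst (λ k → Pointwise _≤_ (blockCountdowns k) (bracketOf (toDyck x))) #N≡n
               (blockCountdowns-≤-toDyck x)))
    size-b : size b ≡ m * n
    size-b = begin
      size b          ≡⟨ ≼-size b≼t ⟩
      size t          ≡⟨ sym (#U-dyck t) ⟩
      #U (dyck t)     ≡⟨ cong #U t≡x ⟩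
      #U (toDyck x)   ≡⟨ #U-toDyck x ⟩
      m * #N x        ≡⟨ cong (m *_) #N≡n ⟩
      m * n           ∎
      where open ≡-Reasoning

  lowestPath : ℕ → List BStep
  lowestPath zero    = []
  lowestPath (suc j) = N ∷ replicate m E ++ lowestPath j

  toDyck-replicate-E : ∀ j r → toDyck (replicate j E ++ r) ≡ replicate j D ++ toDyck r
  toDyck-replicate-E zero    r = refl
  toDyck-replicate-E (suc j) r = cong (D ∷_) (toDyck-replicate-E j r)

  #N-replicate-E : ∀ j r → #N (replicate j E ++ r) ≡ #N r
  #N-replicate-E zero    r = refl
  #N-replicate-E (suc j) r = #N-replicate-E j r

  toDyck-lowestPath : ∀ j → toDyck (lowestPath j) ≡ base m j
  toDyck-lowestPath zero    = refl
  toDyck-lowestPath (suc j) = trans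
    (cong (replicate m U ++_)
      (trans (toDyck-replicate-E m (lowestPath j)) (cong (replicate m D ++_) (toDyck-lowestPath j))))
    (sym (base-suc j))

  #N-lowestPath : ∀ j → #N (lowestPath j) ≡ j
  #N-lowestPath zero    = refl
  #N-lowestPath (suc j) = cong suc (trans (#N-replicate-E m (lowestPath j)) (#N-lowestPath j))

-- The lattice of ballot paths

prec-irreflexive : ∀ {m P Q} → Prec m P Q → P ≢ Q
prec-irreflexive (A , _ , _ , ((_ , refl) , _) , refl , refl) e with ++-cancelˡ A _ _ e
... | ()

module BallotLattice (m n : ℕ) .{{_ : NonZero m}} where
  open Embedding m

  _⊑_ : Ballot m n → Ballot m n → Set
  _⊑_ = _≤B_ {m} {n}

  toDyckPath : ∀ {p} → BallotPath m n p → DyckPath (m * n) (toDyck p)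
  toDyckPath {p} (isB , #N≡n) = isBallot⇒isDyck isB , trans (#U-toDyck p) (cong (m *_) #N≡n)

  fromDyckPath : ∀ {q} → DyckPath (m * n) (toDyck q) → BallotPath m n q
  fromDyckPath {q} (isD , #U≡) = isDyck⇒isBallot isD , *-cancelˡ-≡ (#N q) n m (trans (sym (#U-toDyck q)) #U≡)

  precs⇒tamari : ∀ {p q} → Star (PrecOn m n) p q → toDyck p ≤T[ m * n ] toDyck q
  precs⇒tamari = gmap toDyck λ (bp , bq , prec) → toDyckPath bp , toDyckPath bq , prec⇒cover prec

  -- The image of toDyck is an up-set of the Tamari lattice, and ≺ is the restricted covering relation.
  lift-tamari : ∀ {p Q} → BallotPath m n p → toDyck p ≤T[ m * n ] Q →
    ∃ λ q → Q ≡ toDyck q × BallotPath m n q × Star (PrecOn m n) p q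
  lift-tamari bp ε = _ , refl , bp , ε
  lift-tamari {p} bp ((_ , dq , cover) ◅ covers) with cover⇒prec p _ cover
  ... | _ , refl , prec with lift-tamari (fromDyckPath dq) covers
  ... | q , Q≡ , bq , precs = q , Q≡ , bq , (bp , fromDyckPath dq , prec) ◅ precs

  tamari⇒precs : ∀ {p q} → BallotPath m n p → toDyck p ≤T[ m * n ] toDyck q → Star (PrecOn m n) p q
  tamari⇒precs {p} bp ≤T with lift-tamari bp ≤T
  ... | q′ , q≡q′ , _ , precs = subst (Star (PrecOn m n) p) (toDyck-injective _ _ (sym q≡q′)) precs

  tree : Ballot m n → Tree
  tree (_ , isB , _) = proj₁ (isDyck⇒tree (isBallot⇒isDyck isB))

  dyck-tree : ∀ x → dyck (tree x) ≡ toDyck (proj₁ x)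
  dyck-tree (_ , isB , _) = proj₂ (isDyck⇒tree (isBallot⇒isDyck isB))

  size-tree : ∀ x → size (tree x) ≡ m * n
  size-tree x = trans (sym (#U-dyck (tree x))) (trans (cong #U (dyck-tree x)) (proj₂ (toDyckPath (proj₂ x))))

  tree-injective : ∀ x y → tree x ≡ tree y → proj₁ x ≡ proj₁ y
  tree-injective x y e = toDyck-injective _ _ (trans (sym (dyck-tree x)) (trans (cong dyck e) (dyck-tree y)))

  ⊑⇒≼ : ∀ x y → x ⊑ y → tree x ≼ tree y
  ⊑⇒≼ x y x⊑y with tamari⇒rotations (precs⇒tamari x⊑y) (tree x) (dyck-tree x)
  ... | t , t≡y , rotations =
    subst (tree x ≼_) (dyck-injective _ _ (trans t≡y (sym (dyck-tree y)))) (rotations-≼ rotations)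

  ≼⇒tamari : ∀ x {t} → tree x ≼ t → toDyck (proj₁ x) ≤T[ m * n ] dyck t
  ≼⇒tamari x x≼t = subst (λ p → p ≤T[ m * n ] _) (dyck-tree x)
    (rotations⇒tamari (≼⇒rotations _ _ _ ≤-refl x≼t) (size-tree x))

  ≼⇒⊑ : ∀ x y → tree x ≼ tree y → x ⊑ y
  ≼⇒⊑ x y x≼y = tamari⇒precs (proj₂ x) (subst (_ ≤T[ m * n ]_) (dyck-tree y) (≼⇒tamari x x≼y))

  ≼-lift : ∀ x t → tree x ≼ t → ∃ λ z → tree z ≡ t
  ≼-lift x t x≼t with lift-tamari (proj₂ x) (≼⇒tamari x x≼t)
  ... | q , t≡q , bq , _ = (q , bq) , dyck-injective _ _ (trans (dyck-tree (q , bq)) (sym t≡q))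

  lowest : Ballot m n
  lowest = lowestPath m n ,
    isDyck⇒isBallot (subst IsDyck (sym (toDyck-lowestPath m n)) (DyckFrom⇒IsDyckFrom (base-DyckFrom m n))) ,
    #N-lowestPath m n

  base≤T : ∀ x → base m n ≤T[ m * n ] toDyck (proj₁ x)
  base≤T (p , bp) = base≤toDyck m n p bp

  base≤T⇒lowest≤T : ∀ {Q} → base m n ≤T[ m * n ] Q → toDyck (lowestPath m n) ≤T[ m * n ] Q
  base≤T⇒lowest≤T = subst (λ b → b ≤T[ m * n ] _) (sym (toDyck-lowestPath m n))

  lowest-⊑ : ∀ x → lowest ⊑ x
  lowest-⊑ x = tamari⇒precs (proj₂ lowest) (base≤T⇒lowest≤T (base≤T x))

  sameSize : ∀ x y → size (tree x) ≡ size (tree y)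
  sameSize x y = trans (size-tree x) (sym (size-tree y))

  joinLift : ∀ x y → ∃ λ z → IsJoin (tree x) (tree y) (tree z)
  joinLift x y = let z , z≡join = ≼-lift x _ (proj₁ isJoin) in
    z , subst (IsJoin (tree x) (tree y)) (sym z≡join) isJoin
    where
    isJoin : IsJoin (tree x) (tree y) (join (tree x) (tree y))
    isJoin = join-isJoin (tree x) (tree y) (sameSize x y)

  lowest≼meet : ∀ x y → tree lowest ≼ meet (tree x) (tree y)
  lowest≼meet x y = proj₂ (proj₂ (meet-isMeet (tree x) (tree y) (sameSize x y))) (tree lowest)
    (⊑⇒≼ lowest x (lowest-⊑ x)) (⊑⇒≼ lowest y (lowest-⊑ y))

  -- Meets stay above the lowest path, hence in the image.
  meetLift : ∀ x y → ∃ λ z → IsMeet (tree x) (tree y) (tree z)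
  meetLift x y = let z , z≡meet = ≼-lift lowest _ (lowest≼meet x y) in
    z , subst (IsMeet (tree x) (tree y)) (sym z≡meet) (meet-isMeet (tree x) (tree y) (sameSize x y))

  _∨_ _∧_ : Ballot m n → Ballot m n → Ballot m n
  x ∨ y = proj₁ (joinLift x y)
  x ∧ y = proj₁ (meetLift x y)

  IsJoin⇒supremum : ∀ x y j → IsJoin (tree x) (tree y) (tree j) →
    x ⊑ j × y ⊑ j × (∀ z → x ⊑ z → y ⊑ z → j ⊑ z)
  IsJoin⇒supremum x y j (x≼j , y≼j , least) =
    ≼⇒⊑ x j x≼j , ≼⇒⊑ y j y≼j ,
    λ z x⊑z y⊑z → ≼⇒⊑ j z (least (tree z) (⊑⇒≼ x z x⊑z) (⊑⇒≼ y z y⊑z))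

  IsMeet⇒infimum : ∀ x y i → IsMeet (tree x) (tree y) (tree i) →
    i ⊑ x × i ⊑ y × (∀ z → z ⊑ x → z ⊑ y → z ⊑ i)
  IsMeet⇒infimum x y i (i≼x , i≼y , greatest) =
    ≼⇒⊑ i x i≼x , ≼⇒⊑ i y i≼y ,
    λ z z⊑x z⊑y → ≼⇒⊑ z i (greatest (tree z) (⊑⇒≼ z x z⊑x) (⊑⇒≼ z y z⊑y))

  isLattice : IsLattice (_≈B_ {m} {n}) _⊑_ _∨_ _∧_
  isLattice = record
    { isPartialOrder = record
      { isPreorder = record
        { isEquivalence = record { refl = refl ; sym = sym ; trans = trans }
        ; reflexive     = λ {x} x≈y → subst (Star (PrecOn m n) (proj₁ x)) x≈y ε
        ; trans         = _◅◅_
        }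
      ; antisym = λ {x} {y} x⊑y y⊑x →
          tree-injective x y (≼-antisym (⊑⇒≼ x y x⊑y) (⊑⇒≼ y x y⊑x))
      }
    ; supremum = λ x y → IsJoin⇒supremum x y (x ∨ y) (proj₂ (joinLift x y))
    ; infimum  = λ x y → IsMeet⇒infimum x y (x ∧ y) (proj₂ (meetLift x y))
    }

  toUpSet : Ballot m n → UpSet m n
  toUpSet x = toDyck (proj₁ x) , toDyckPath (proj₂ x) , base≤T x

  fromUpSet′ : (y : UpSet m n) →
    ∃ λ q → proj₁ y ≡ toDyck q × BallotPath m n q × Star (PrecOn m n) (lowestPath m n) q
  fromUpSet′ (_ , _ , base≤q) = lift-tamari (proj₂ lowest) (base≤T⇒lowest≤T base≤q)

  fromUpSet : UpSet m n → Ballot m n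
  fromUpSet y = let q , _ , bq , _ = fromUpSet′ y in q , bq

  toDyck-fromUpSet : ∀ y → proj₁ y ≡ toDyck (proj₁ (fromUpSet y))
  toDyck-fromUpSet y = proj₁ (proj₂ (fromUpSet′ y))

  orderIso : OrderIso (_≈B_ {m} {n}) _⊑_ (_≈U_ {m} {n}) (_≤U_ {m} {n})
  orderIso = record
    { to        = toUpSet
    ; from      = fromUpSet
    ; to-cong   = cong toDyck
    ; from-cong = λ {y} {y′} y≈y′ →
        toDyck-injective _ _ (trans (sym (toDyck-fromUpSet y)) (trans y≈y′ (toDyck-fromUpSet y′)))
    ; from-to   = λ x → toDyck-injective _ _ (sym (toDyck-fromUpSet (toUpSet x)))
    ; to-from   = λ y → sym (toDyck-fromUpSet y)
    ; monotone  = λ x y → mk⇔ precs⇒tamari (tamari⇒precs (proj₂ x))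
    }

  prec⇒rotation : ∀ x y → Prec m (proj₁ x) (proj₁ y) → Rotation (tree x) (tree y)
  prec⇒rotation x y prec
    with cover⇒rotation (subst (λ P → TamariCover P _) (sym (dyck-tree x)) (prec⇒cover prec))
  ... | t , t≡y , ρ = subst (Rotation (tree x)) (dyck-injective _ _ (trans t≡y (sym (dyck-tree y)))) ρ

  prec⇒covers : ∀ x y → Prec m (proj₁ x) (proj₁ y) → Covers (_≈B_ {m} {n}) _⊑_ x y
  prec⇒covers x@(p , bp) y prec = (bp , proj₂ y , prec) ◅ ε , prec-irreflexive {m} prec , between
    where
    between : ∀ z → x ⊑ z → z ⊑ y → proj₁ z ≡ p ⊎ proj₁ z ≡ proj₁ y
    between (_ , _) ε _ = inj₁ refl
    between z ((_ , bx₁ , prec₁) ◅ x₁⊑z) z⊑y =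
      inj₂ (tree-injective z y (≼-antisym (⊑⇒≼ z y z⊑y) y≼z))
      where
      x₁ : Ballot m n
      x₁ = _ , bx₁
      x₁≡y : tree x₁ ≡ tree y
      x₁≡y = rotation-≼-unique (prec⇒rotation x x₁ prec₁) (prec⇒rotation x y prec)
        (≼-trans (⊑⇒≼ x₁ z x₁⊑z) (⊑⇒≼ z y z⊑y))
      y≼z : tree y ≼ tree z
      y≼z = subst (_≼ tree z) x₁≡y (⊑⇒≼ x₁ z x₁⊑z)

  covers⇒prec : ∀ x y → Covers (_≈B_ {m} {n}) _⊑_ x y → Prec m (proj₁ x) (proj₁ y)
  covers⇒prec (p , _) (_ , _) (ε , x≉y , _) = ⊥-elim (x≉y refl)
  covers⇒prec x y ((bx , bx₁ , prec) ◅ x₁⊑y , _ , between)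
    with between (_ , bx₁) ((bx , bx₁ , prec) ◅ ε) x₁⊑y
  ... | inj₁ x₁≈x = ⊥-elim (prec-irreflexive {m} prec (sym x₁≈x))
  ... | inj₂ x₁≈y = subst (Prec m (proj₁ x)) x₁≈y prec

proposition2p2 : (m n : ℕ) → 1 ≤ m →
    Σ (Ballot m n → Ballot m n → Ballot m n) (λ _∨_ →
      Σ (Ballot m n → Ballot m n → Ballot m n) (λ _∧_ →
        IsLattice (_≈B_ {m} {n}) (_≤B_ {m} {n}) _∨_ _∧_))
    × OrderIso (_≈B_ {m} {n}) (_≤B_ {m} {n}) (_≈U_ {m} {n}) (_≤U_ {m} {n})
    × (∀ (x y : Ballot m n) →
         Prec m (proj₁ x) (proj₁ y) ⇔ Covers (_≈B_ {m} {n}) (_≤B_ {m} {n}) x y)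
proposition2p2 m n 1≤m =
  (_∨_ , _∧_ , isLattice) , orderIso , λ x y → mk⇔ (prec⇒covers x y) (covers⇒prec x y)
  where
  instance
    m-nonZero : NonZero m
    m-nonZero = >-nonZero 1≤m
  open BallotLattice m n
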